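{- For all integers $n\ge0$ and $s\ge1$, the number of ordered trees with $n$ edges having exactly $s$ unprotected nodes is $$\sum_{j=s}^{n}\frac{1}{j}\binom{j}{s}\sum_{i=j}^{s+j-1}\binom{i-1}{j-1}\binom{n+s-i-1}{s-1}\binom{n-i}{n-s-j+1}.$$
   Context: An ordered tree is a rooted tree in which the children of each node are linearly ordered; its size is its number of edges. A leaf is a node with no children; an internal node has at least one child. An internal node (the root included) is unprotected if at least one of its children is a leaf. Binomial coefficients $\binom{x}{j}$ with $j<0$ are $0$; empty sums are $0$. -}

module Defs where

open import Data.Nat using (ℕ; zero; suc; _+_; _∸_)
open import Data.Nat.Combinatorics using (_C_)
open import Data.Integer as ℤ using (ℤ; +_; -[1+_])
open import Data.Rational as Q using (ℚ; 0ℚ)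
open import Data.List using (List; []; _∷_)
open import Data.Bool using (Bool; true; false; _∨_; if_then_else_)

data Tree : Set where
  node : List Tree → Tree

isLeaf : Tree → Bool
isLeaf (node [])      = true
isLeaf (node (_ ∷ _)) = false

someLeaf : List Tree → Bool
someLeaf []       = false
someLeaf (t ∷ ts) = isLeaf t ∨ someLeaf ts

mutual
  edges : Tree → ℕ
  edges (node cs) = edgesF cs

  edgesF : List Tree → ℕ
  edgesF []       = 0
  edgesF (t ∷ ts) = suc (edges t + edgesF ts)

mutual
  unprotected : Tree → ℕ
  unprotected (node cs) = (if someLeaf cs then 1 else 0) + unprotectedF cs

  unprotectedF : List Tree → ℕ
  unprotectedF []       = 0
  unprotectedF (t ∷ ts) = unprotected t + unprotectedF ts

-- Generalised binomial coefficient binom x k for integers x, k: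
-- 0 if k < 0; the usual x choose k if x ≥ 0;
-- (-1)^k (k - x - 1 choose k) if x < 0 (i.e. x(x-1)...(x-k+1)/k!).
binom : ℤ → ℤ → ℤ
binom x -[1+ _ ]          = + 0
binom (+ m) (+ k)         = + (m C k)
binom -[1+ m ] (+ k)      = sign k (+ ((k + m) C k))
  where
  sign : ℕ → ℤ → ℤ
  sign zero    z = z
  sign (suc k) z = ℤ.- (sign k z)

clamp : ℤ → ℕ
clamp (+ m)    = m
clamp -[1+ _ ] = 0

sumFromTo : ℤ → ℤ → (ℤ → ℚ) → ℚ
sumFromTo a b f = go (clamp ((b ℤ.+ + 1) ℤ.- a)) a
  where
  go : ℕ → ℤ → ℚ
  go zero    i = 0ℚ
  go (suc c) i = f i Q.+ go c (i ℤ.+ + 1)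

-- the rational 1/j for an integer j ≥ 1 (only ever applied to j ≥ 1 below;
-- the value 0 for j ≤ 0 is a dummy)
recip : ℤ → ℚ
recip (+ zero)  = 0ℚ
recip (+ suc m) = + 1 Q./ suc m
recip -[1+ _ ]  = 0ℚ

formula : ℤ → ℤ → ℚ
formula n s =
  sumFromTo s n (λ j →
    recip j Q.* (binom j s Q./ 1) Q.*
    sumFromTo j (s ℤ.+ j ℤ.- + 1) (λ i →
      (binom (i ℤ.- + 1) (j ℤ.- + 1)
        ℤ.* binom (n ℤ.+ s ℤ.- i ℤ.- + 1) (s ℤ.- + 1)
        ℤ.* binom (n ℤ.- i) (n ℤ.- s ℤ.- j ℤ.+ + 1)) Q./ 1))

-- An ordered tree with at least one edge is coded by the preorder word of its internal nodes,
-- each written as the list of leaf flags of its children.  These words are exactly the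
-- Łukasiewicz words of one tree (a letter has as many internal children as false flags), and
-- edges and unprotected nodes are sums over the letters of the number of flags and of the
-- indicator that some flag is true.  By the cycle lemma the Łukasiewicz words of length j,
-- each taken with one of its j rotations, correspond to the balanced words of length j
-- (j − 1 false flags in all), which are counted directly: a letter is false^a followed either
-- by false or by true and a free tail.  The s letters with a tail are chosen in C(j, s) ways,
-- the a's form a composition of m = i − j into j parts, and the s tails have total length
-- n − i with s − 1 − m false flags; these give the three binomials of the inner sum, and
-- dividing by j and summing over j gives the formula.

module Submission where

open import Defs
open import Data.Nat using (ℕ; zero; suc; _+_; _*_; _∸_; _≤_; _<_; s≤s; z≤n; _≤?_; _<?_; _≟_)
open import Data.Nat.Properties
open import Data.Nat.Tactic.RingSolver using (solve-∀)
open import Data.Nat.DivMod using (m*n/n≡m; 0/n≡0) renaming (_/_ to _div_)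
open import Data.Nat.Combinatorics using (_C_; nCn≡1; nCk≡nC[n∸k]; k>n⇒nCk≡0; nCk+nC[k+1]≡[n+1]C[k+1])
open import Data.Nat.ListAction using (sum)
open import Data.Nat.ListAction.Properties using (sum-++)
open import Data.Integer as ℤ using (ℤ; +_; -[1+_])
import Data.Integer.Properties as ℤ
import Data.Integer.Tactic.RingSolver as ℤ-Solver
open import Data.Rational as ℚ using (ℚ; _/_; 0ℚ; toℚᵘ)
import Data.Rational.Properties as ℚ
open import Data.Rational.Properties using (toℚᵘ-injective; toℚᵘ-fromℚᵘ; toℚᵘ-homo-+; toℚᵘ-homo-*)
open import Data.Rational.Unnormalised as ℚᵘ using (mkℚᵘ; *≡*)
import Data.Rational.Unnormalised.Properties as ℚᵘ
open import Data.Bool using (Bool; true; false; _∨_; if_then_else_)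
open import Data.Bool.ListAction using (or)
open import Data.Maybe using (Maybe; just; nothing)
open import Data.List using (List; []; _∷_; _++_; length; map; take; drop; replicate)
open import Data.List.Properties
  using (∷-injective; ++-assoc; ++-identityʳ; length-++; length-++-comm; length-map; length-replicate; map-++; take++drop≡id; length-take; length-drop)
open import Data.Vec as Vec using (Vec; []; _∷_; toList) renaming (_++_ to _++ᵛ_)
open import Data.Vec.Properties using (toList-++; length-toList) renaming (take++drop≡id to take++drop≡idᵛ)
open import Data.Vec.Relation.Unary.All using (All; []; _∷_)
open import Data.Fin as Fin using (Fin; toℕ; fromℕ<)
open import Data.Fin.Properties using (+↔⊎; *↔×; 1↔⊤; toℕ-fromℕ<; toℕ<n; toℕ-injective) renaming (_≟_ to _≟ᶠ_)
open import Data.Fin.Permutation using (↔⇒≡)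
open import Data.Product using (Σ; ∃; ∃₂; _×_; _,_; proj₁; proj₂)
open import Data.Product.Function.NonDependent.Propositional using (_×-↔_)
open import Data.Sum using (_⊎_; inj₁; inj₂)
open import Data.Sum.Function.Propositional using (_⊎-↔_)
open import Data.Empty using (⊥-elim)
open import Data.Unit using (tt)
open import Function.Bundles using (_↔_; mk↔ₛ′; Inverse)
open import Function.Properties.Inverse using (↔-refl; ↔-sym; ↔-trans)
open import Relation.Nullary using (Dec; yes; no; ¬_; Irrelevant)
open import Relation.Binary.PropositionalEquality
open import Axiom.UniquenessOfIdentityProofs.WithK using (uip)

-- Finite cardinalities

×-irrelevant : {A B : Set} → Irrelevant A → Irrelevant B → Irrelevant (A × B)
×-irrelevant irrA irrB (a , b) (a′ , b′) = cong₂ _,_ (irrA a a′) (irrB b b′)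

Σ-≡-irrelevant : {A : Set} {P : A → Set} → (∀ a → Irrelevant (P a)) →
                 ∀ {a a′} {p : P a} {p′ : P a′} → a ≡ a′ → (a , p) ≡ (a′ , p′)
Σ-≡-irrelevant irr {p = p} {p′} refl = cong (_ ,_) (irr _ p p′)

¬⇒↔Fin0 : {A : Set} → ¬ A → A ↔ Fin 0
¬⇒↔Fin0 ¬a = mk↔ₛ′ (λ a → ⊥-elim (¬a a)) (λ ()) (λ ()) (λ a → ⊥-elim (¬a a))

Irrelevant⇒↔Fin1 : {A : Set} → Irrelevant A → A → A ↔ Fin 1
Irrelevant⇒↔Fin1 irr a = ↔-trans (mk↔ₛ′ (λ _ → tt) (λ _ → a) (λ _ → refl) (irr a)) (↔-sym 1↔⊤)

Dec⇒↔Fin : {A : Set} → Irrelevant A → Dec A → ∃ λ k → A ↔ Fin k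
Dec⇒↔Fin irr (yes a) = 1 , Irrelevant⇒↔Fin1 irr a
Dec⇒↔Fin irr (no ¬a) = 0 , ¬⇒↔Fin0 ¬a

Σ-Fin0↔Fin0 : {P : Fin 0 → Set} → Σ (Fin 0) P ↔ Fin 0
Σ-Fin0↔Fin0 = ¬⇒↔Fin0 (λ ())

Σ-Fin-suc↔⊎ : ∀ {n} {P : Fin (suc n) → Set} → Σ (Fin (suc n)) P ↔ (P Fin.zero ⊎ Σ (Fin n) (λ i → P (Fin.suc i)))
Σ-Fin-suc↔⊎ = mk↔ₛ′
  (λ { (Fin.zero , x) → inj₁ x ; (Fin.suc i , x) → inj₂ (i , x) })
  (λ { (inj₁ x) → Fin.zero , x ; (inj₂ (i , x)) → Fin.suc i , x })
  (λ { (inj₁ x) → refl ; (inj₂ (i , x)) → refl })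
  (λ { (Fin.zero , x) → refl ; (Fin.suc i , x) → refl })

⊎-Fin↔Fin : ∀ {A B : Set} {m n} → A ↔ Fin m → B ↔ Fin n → (A ⊎ B) ↔ Fin (m + n)
⊎-Fin↔Fin eA eB = ↔-trans (eA ⊎-↔ eB) (↔-sym +↔⊎)

×-Fin↔Fin : ∀ {A B : Set} {m n} → A ↔ Fin m → B ↔ Fin n → (A × B) ↔ Fin (m * n)
×-Fin↔Fin eA eB = ↔-trans (eA ×-↔ eB) (↔-sym *↔×)

∑ : ℕ → (ℕ → ℕ) → ℕ
∑ zero    f = 0
∑ (suc n) f = f 0 + ∑ n (λ k → f (suc k))

Σ-Fin↔∑ : ∀ n (P : ℕ → Set) (c : ℕ → ℕ) → (∀ {k} → k < n → P k ↔ Fin (c k)) →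
          Σ (Fin n) (λ i → P (toℕ i)) ↔ Fin (∑ n c)
Σ-Fin↔∑ zero    P c e = Σ-Fin0↔Fin0
Σ-Fin↔∑ (suc n) P c e = ↔-trans Σ-Fin-suc↔⊎
  (⊎-Fin↔Fin (e (s≤s z≤n)) (Σ-Fin↔∑ n (λ k → P (suc k)) (λ k → c (suc k)) (λ k<n → e (s≤s k<n))))

Σ-Fin-Dec↔Fin : ∀ n {P : Fin n → Set} → (∀ i → Irrelevant (P i)) → (∀ i → Dec (P i)) →
                ∃ λ k → Σ (Fin n) P ↔ Fin k
Σ-Fin-Dec↔Fin zero    irr P? = 0 , Σ-Fin0↔Fin0
Σ-Fin-Dec↔Fin (suc n) irr P?
  with Dec⇒↔Fin (irr Fin.zero) (P? Fin.zero) | Σ-Fin-Dec↔Fin n (λ i → irr (Fin.suc i)) (λ i → P? (Fin.suc i))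
... | k , e | l , e′ = k + l , ↔-trans Σ-Fin-suc↔⊎ (⊎-Fin↔Fin e e′)

×-Fin-suc-cancel : ∀ {X : Set} k S → (X × Fin (suc k)) ↔ Fin S → (X ↔ Fin (S div suc k)) × S div suc k * suc k ≡ S
×-Fin-suc-cancel {X} k S e = subst (λ V → X ↔ Fin V) (sym S/k≡V) X↔Fin , trans (cong (_* suc k) S/k≡V) V*k≡S
  where
  open Inverse e
  Fibre : Set
  Fibre = Σ (Fin S) (λ y → proj₂ (from y) ≡ Fin.zero)
  fibre-count : ∃ λ V → Fibre ↔ Fin V
  fibre-count = Σ-Fin-Dec↔Fin S (λ _ → uip) (λ y → proj₂ (from y) ≟ᶠ Fin.zero)
  V : ℕ
  V = proj₁ fibre-count
  X↔Fibre : X ↔ Fibre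
  X↔Fibre = mk↔ₛ′ (λ x → to (x , Fin.zero) , cong proj₂ (strictlyInverseʳ (x , Fin.zero)))
                  (λ (y , _) → proj₁ (from y))
                  (λ (y , p) → Σ-≡-irrelevant (λ _ → uip) (to∘from y p))
                  (λ x → cong proj₁ (strictlyInverseʳ (x , Fin.zero)))
    where
    to∘from : ∀ y → proj₂ (from y) ≡ Fin.zero → to (proj₁ (from y) , Fin.zero) ≡ y
    to∘from y p = trans (cong (λ z → to (proj₁ (from y) , z)) (sym p)) (strictlyInverseˡ y)
  X↔Fin : X ↔ Fin V
  X↔Fin = ↔-trans X↔Fibre (proj₂ fibre-count)
  V*k≡S : V * suc k ≡ S
  V*k≡S = ↔⇒≡ (↔-trans (↔-sym (×-Fin↔Fin X↔Fin ↔-refl)) e)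
  S/k≡V : S div suc k ≡ V
  S/k≡V = trans (cong (_div suc k) (sym V*k≡S)) (m*n/n≡m V (suc k))

Σ-↔-irrelevant : {A B : Set} {P : A → Set} {Q : B → Set} (e : A ↔ B) →
                 (∀ a → Irrelevant (P a)) → (∀ b → Irrelevant (Q b)) →
                 (∀ a → P a → Q (Inverse.to e a)) → (∀ b → Q b → P (Inverse.from e b)) → Σ A P ↔ Σ B Q
Σ-↔-irrelevant e P-irr Q-irr f g = mk↔ₛ′
  (λ (a , p) → to a , f a p) (λ (b , q) → from b , g b q)
  (λ (b , q) → Σ-≡-irrelevant Q-irr (strictlyInverseˡ b))
  (λ (a , p) → Σ-≡-irrelevant P-irr (strictlyInverseʳ a))
  where open Inverse e

-- Łukasiewicz words and the cycle lemma

total : {A : Set} → (A → ℕ) → List A → ℕ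
total f xs = sum (map f xs)

total-++ : {A : Set} (f : A → ℕ) (xs ys : List A) → total f (xs ++ ys) ≡ total f xs + total f ys
total-++ f xs ys = trans (cong sum (map-++ f xs ys)) (sum-++ (map f xs) (map f ys))

total-rotate : {A : Set} (f : A → ℕ) (xs ys : List A) → total f (xs ++ ys) ≡ total f (ys ++ xs)
total-rotate f xs ys = begin
  total f (xs ++ ys)          ≡⟨ total-++ f xs ys ⟩
  total f xs + total f ys     ≡⟨ +-comm (total f xs) _ ⟩
  total f ys + total f xs     ≡⟨ total-++ f ys xs ⟨
  total f (ys ++ xs)          ∎
  where open ≡-Reasoning

++-≢-[]ʳ : {A : Set} (xs : List A) {ys : List A} → ys ≢ [] → xs ++ ys ≢ []
++-≢-[]ʳ []      ys≢[] = ys≢[]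
++-≢-[]ʳ (_ ∷ _) _     ()

++-≢-[]ˡ : {A : Set} {xs ys : List A} → xs ≢ [] → xs ++ ys ≢ []
++-≢-[]ˡ {xs = []}    xs≢[] = ⊥-elim (xs≢[] refl)
++-≢-[]ˡ {xs = _ ∷ _} _     ()

≢-[]⇒1≤length : {A : Set} {xs : List A} → xs ≢ [] → 1 ≤ length xs
≢-[]⇒1≤length {xs = []}    xs≢[] = ⊥-elim (xs≢[] refl)
≢-[]⇒1≤length {xs = _ ∷ _} _     = s≤s z≤n

take-length-++ : {A : Set} (xs ys : List A) → take (length xs) (xs ++ ys) ≡ xs
take-length-++ []       ys = refl
take-length-++ (x ∷ xs) ys = cong (x ∷_) (take-length-++ xs ys)

drop-length-++ : {A : Set} (xs ys : List A) → drop (length xs) (xs ++ ys) ≡ ys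
drop-length-++ []       ys = refl
drop-length-++ (x ∷ xs) ys = drop-length-++ xs ys

++-split : {A : Set} (a b c d : List A) → a ++ b ≡ c ++ d →
           (∃ λ z → c ≡ a ++ z × b ≡ z ++ d) ⊎ (∃ λ z → a ≡ c ++ z × d ≡ z ++ b)
++-split []      b c       d eq = inj₁ (c , refl , eq)
++-split (x ∷ a) b []      d eq = inj₂ (x ∷ a , refl , sym eq)
++-split (x ∷ a) b (y ∷ c) d eq with ∷-injective eq
... | refl , eq′ with ++-split a b c d eq′
...   | inj₁ (z , c≡az , b≡zd) = inj₁ (z , cong (x ∷_) c≡az , b≡zd)
...   | inj₂ (z , a≡cz , d≡zb) = inj₂ (z , cong (x ∷_) a≡cz , d≡zb)

-- k is the first minimiser of t ↦ f t − t on 1 … n, stated without subtraction.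
record FirstMinimiser (f : ℕ → ℕ) (n k : ℕ) : Set where
  field
    positive : 1 ≤ k
    bounded  : k ≤ n
    minimal  : ∀ t → 1 ≤ t → t ≤ n → f k + t ≤ f t + k
    first    : ∀ t → 1 ≤ t → t < k → f k + t < f t + k

first-minimiser : ∀ f n → ∃ (FirstMinimiser f (suc n))
first-minimiser f zero = 1 , record
  { positive = s≤s z≤n ; bounded = s≤s z≤n
  ; minimal = λ { .1 (s≤s z≤n) (s≤s z≤n) → ≤-refl }
  ; first = λ { t (s≤s z≤n) (s≤s ()) } }
first-minimiser f (suc n) with first-minimiser f n
... | k , m with f (suc (suc n)) + k <? f k + suc (suc n)
...   | yes new-minimum = n′ , record
  { positive = s≤s z≤n ; bounded = ≤-refl
  ; minimal = λ t 1≤t t≤n′ → case-≤ t (λ t≢n′ → <⇒≤ (beats t 1≤t t≤n′ t≢n′))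
  ; first = λ t 1≤t t<n′ → beats t 1≤t (<⇒≤ t<n′) (<⇒≢ t<n′) }
  where
  open FirstMinimiser m
  n′ : ℕ
  n′ = suc (suc n)
  case-≤ : ∀ t → (t ≢ n′ → f n′ + t ≤ f t + n′) → f n′ + t ≤ f t + n′
  case-≤ t otherwise with t ≟ n′
  ... | yes refl = ≤-refl
  ... | no t≢n′  = otherwise t≢n′
  beats : ∀ t → 1 ≤ t → t ≤ n′ → t ≢ n′ → f n′ + t < f t + n′
  beats t 1≤t t≤n′ t≢n′ = +-cancelʳ-< (f k + k) (f n′ + t) (f t + n′)
    (subst₂ _<_ (regroup (f n′) k (f k) t) (swap (f k) n′ (f t) k)
      (+-mono-<-≤ new-minimum (minimal t 1≤t (≤-pred (≤∧≢⇒< t≤n′ t≢n′)))))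
    where
    regroup : ∀ a b c d → a + b + (c + d) ≡ a + d + (c + b)
    regroup = solve-∀
    swap : ∀ a b c d → a + b + (c + d) ≡ c + b + (a + d)
    swap = solve-∀
...   | no ¬new-minimum = k , record
  { positive = positive ; bounded = m≤n⇒m≤1+n bounded
  ; minimal = minimal′ ; first = first }
  where
  open FirstMinimiser m
  minimal′ : ∀ t → 1 ≤ t → t ≤ suc (suc n) → f k + t ≤ f t + k
  minimal′ t 1≤t t≤n′ with t ≟ suc (suc n)
  ... | yes refl = ≮⇒≥ ¬new-minimum
  ... | no t≢n′  = minimal t 1≤t (≤-pred (≤∧≢⇒< t≤n′ t≢n′))

module Łukasiewicz {A : Set} (deg : A → ℕ) where

  -- Łuk r l: l is the preorder word of a forest of r trees, a node a having deg a children.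
  data Łuk : ℕ → List A → Set where
    done : Łuk 0 []
    step : ∀ {r l} (a : A) → Łuk (deg a + r) l → Łuk (suc r) (a ∷ l)

  Łuk-irrelevant : ∀ {r l} → Irrelevant (Łuk r l)
  Łuk-irrelevant done       done       = refl
  Łuk-irrelevant (step a p) (step .a q) = cong (step a) (Łuk-irrelevant p q)

  degs : List A → ℕ
  degs = total deg

  PrefixCriterion : ℕ → List A → Set
  PrefixCriterion r l = (∀ a b → l ≡ a ++ b → b ≢ [] → length a < r + degs a) × r + degs l ≡ length l

  Łuk⇒criterion : ∀ {r l} → Łuk r l → PrefixCriterion r l
  Łuk⇒criterion done = (λ { [] [] _ b≢[] → ⊥-elim (b≢[] refl) }) , refl
  Łuk⇒criterion {suc r} {a ∷ l} (step a p) with Łuk⇒criterion p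
  ... | prefixes , whole = prefixes′ , cong suc (trans (regroup (deg a) r (degs l)) whole)
    where
    regroup : ∀ d r x → r + (d + x) ≡ d + r + x
    regroup = solve-∀
    prefixes′ : ∀ u b → a ∷ l ≡ u ++ b → b ≢ [] → length u < suc r + degs u
    prefixes′ []      b _  _     = s≤s z≤n
    prefixes′ (_ ∷ u) b eq b≢[] with ∷-injective eq
    ... | refl , l≡ub = s≤s (subst (length u <_) (sym (regroup (deg a) r (degs u))) (prefixes u b l≡ub b≢[]))

  criterion⇒Łuk : ∀ r l → PrefixCriterion r l → Łuk r l
  criterion⇒Łuk r       []      (_ , whole) = subst (λ r → Łuk r []) (sym (trans (sym (+-identityʳ r)) whole)) done
  criterion⇒Łuk zero    (a ∷ l) (prefixes , _) with prefixes [] (a ∷ l) refl (λ ())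
  ... | ()
  criterion⇒Łuk (suc r) (a ∷ l) (prefixes , whole) =
    step a (criterion⇒Łuk (deg a + r) l (prefixes′ , trans (sym (regroup (deg a) r (degs l))) (suc-injective whole)))
    where
    regroup : ∀ d r x → r + (d + x) ≡ d + r + x
    regroup = solve-∀
    prefixes′ : ∀ u b → l ≡ u ++ b → b ≢ [] → length u < deg a + r + degs u
    prefixes′ u b l≡ub b≢[] =
      subst (length u <_) (regroup (deg a) r (degs u)) (≤-pred (prefixes (a ∷ u) b (cong (a ∷_) l≡ub) b≢[]))

  Łuk⇒prefix-bound : ∀ {a b} → Łuk 1 (a ++ b) → b ≢ [] → length a ≤ degs a
  Łuk⇒prefix-bound {a} {b} p b≢[] = ≤-pred (proj₁ (Łuk⇒criterion p) a b refl b≢[])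

  Balanced : List A → Set
  Balanced v = degs v + 1 ≡ length v

  Łuk⇒Balanced : ∀ {w} → Łuk 1 w → Balanced w
  Łuk⇒Balanced {w} p = trans (+-comm (degs w) 1) (proj₂ (Łuk⇒criterion p))

  Balanced-rotate : ∀ xs ys → Balanced (xs ++ ys) → Balanced (ys ++ xs)
  Balanced-rotate xs ys bal =
    trans (cong (_+ 1) (total-rotate deg ys xs)) (trans bal (length-++-comm xs ys))

  ¬Łuk-both-rotations : ∀ {z u} → z ≢ [] → u ≢ [] → Łuk 1 (z ++ u) → ¬ Łuk 1 (u ++ z)
  ¬Łuk-both-rotations {z} {u} z≢[] u≢[] p q = <-irrefl refl (begin-strict
    length (z ++ u)              ≡⟨ length-++ z ⟩
    length z + length u          ≤⟨ +-mono-≤ (Łuk⇒prefix-bound p u≢[]) (Łuk⇒prefix-bound q z≢[]) ⟩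
    degs z + degs u              ≡⟨ total-++ deg z u ⟨
    degs (z ++ u)                <⟨ m<m+n (degs (z ++ u)) (s≤s z≤n) ⟩
    degs (z ++ u) + 1            ≡⟨ Łuk⇒Balanced p ⟩
    length (z ++ u)              ∎)
    where open ≤-Reasoning

  ŁukRotation : List A → Set
  ŁukRotation v = ∃₂ λ x y → v ≡ x ++ y × x ≢ [] × Łuk 1 (y ++ x)

  rotation-unique : ∀ x y x′ y′ → x ++ y ≡ x′ ++ y′ → x ≢ [] → x′ ≢ [] →
                    Łuk 1 (y ++ x) → Łuk 1 (y′ ++ x′) → x ≡ x′ × y ≡ y′
  rotation-unique x y x′ y′ eq x≢[] x′≢[] p p′ with ++-split x y x′ y′ eq
  ... | inj₁ ([] , x′≡x , y≡y′) = sym (trans x′≡x (++-identityʳ x)) , y≡y′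
  ... | inj₁ (z@(_ ∷ _) , x′≡xz , y≡zy′) = ⊥-elim (¬Łuk-both-rotations (λ ()) (++-≢-[]ʳ y′ x≢[])
        (subst (Łuk 1) (trans (cong (_++ x) y≡zy′) (++-assoc z y′ x)) p)
        (subst (Łuk 1) (trans (cong (y′ ++_) x′≡xz) (sym (++-assoc y′ x z))) p′))
  ... | inj₂ ([] , x≡x′ , y′≡y) = trans x≡x′ (++-identityʳ x′) , sym y′≡y
  ... | inj₂ (z@(_ ∷ _) , x≡x′z , y′≡zy) = ⊥-elim (¬Łuk-both-rotations (λ ()) (++-≢-[]ʳ y x′≢[])
        (subst (Łuk 1) (trans (cong (_++ x′) y′≡zy) (++-assoc z y x′)) p′)
        (subst (Łuk 1) (trans (cong (y ++_) x≡x′z) (sym (++-assoc y x′ z))) p))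

  -- Each proper prefix of y ++ x has length < 1 + degs: inside y by minimality at k,
  -- past y by the strict minimality before k together with the balance of v.
  module RotationAtFirstMinimiser (v : List A) (bal : Balanced v) {k : ℕ}
                  (min : FirstMinimiser (λ t → degs (take t v)) (length v) k) where
    open FirstMinimiser min

    x y : List A
    x = take k v
    y = drop k v

    v≡xy : v ≡ x ++ y
    v≡xy = sym (take++drop≡id k v)

    |x|≡k : length x ≡ k
    |x|≡k = trans (length-take k v) (m≤n⇒m⊓n≡m bounded)

    x≢[] : x ≢ []
    x≢[] x≡[] = <-irrefl refl (subst (1 ≤_) (trans (sym |x|≡k) (cong length x≡[])) positive)

    degs-take : ∀ a z → v ≡ a ++ z → degs (take (length a) v) ≡ degs a
    degs-take a z v≡az = cong degs (trans (cong (take (length a)) v≡az) (take-length-++ a z))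

    balance : degs x + degs y + 1 ≡ k + length y
    balance = begin
      degs x + degs y + 1      ≡⟨ cong (_+ 1) (total-++ deg x y) ⟨
      degs (x ++ y) + 1        ≡⟨ cong (λ w → degs w + 1) v≡xy ⟨
      degs v + 1               ≡⟨ bal ⟩
      length v                 ≡⟨ cong length v≡xy ⟩
      length (x ++ y)          ≡⟨ length-++ x ⟩
      length x + length y      ≡⟨ cong (_+ length y) |x|≡k ⟩
      k + length y             ∎
      where open ≡-Reasoning

    tail-prefix-bound : ∀ a z → y ≡ a ++ z → length a ≤ degs a
    tail-prefix-bound a z y≡az = +-cancelˡ-≤ (degs x + k) (length a) (degs a) (begin
      degs x + k + length a
        ≡⟨ +-assoc (degs x) k (length a) ⟩
      degs x + (k + length a)
        ≡⟨ cong (λ i → degs x + i) (trans (length-++ x) (cong (_+ length a) |x|≡k)) ⟨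
      degs x + t
        ≤⟨ minimal t 1≤t t≤|v| ⟩
      degs (take t v) + k
        ≡⟨ cong (_+ k) (trans (degs-take (x ++ a) z v≡xaz) (total-++ deg x a)) ⟩
      degs x + degs a + k
        ≡⟨ regroup (degs x) (degs a) k ⟩
      degs x + k + degs a ∎)
      where
      open ≤-Reasoning
      regroup : ∀ a b c → a + b + c ≡ a + c + b
      regroup = solve-∀
      v≡xaz : v ≡ (x ++ a) ++ z
      v≡xaz = trans v≡xy (trans (cong (x ++_) y≡az) (sym (++-assoc x a z)))
      t : ℕ
      t = length (x ++ a)
      1≤t : 1 ≤ t
      1≤t = ≢-[]⇒1≤length (++-≢-[]ˡ x≢[])
      t≤|v| : t ≤ length v
      t≤|v| = subst (t ≤_) (cong length (sym v≡xaz)) (subst (t ≤_) (sym (length-++ (x ++ a))) (m≤m+n t (length z)))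

    head-prefix-bound : ∀ z b → x ≡ z ++ b → z ≢ [] → b ≢ [] → length (y ++ z) ≤ degs (y ++ z)
    head-prefix-bound z b x≡zb z≢[] b≢[] = subst₂ _≤_ (sym (length-++ y)) (sym (total-++ deg y z))
      (+-cancelˡ-≤ (degs x + 1) (length y + length z) (degs y + degs z) (begin
        degs x + 1 + (length y + length z)   ≡⟨ regroup (degs x) (length y) (length z) ⟩
        suc (degs x + t) + length y           ≤⟨ +-monoˡ-≤ (length y) (first t 1≤t t<k) ⟩
        degs (take t v) + k + length y        ≡⟨ cong (λ d → d + k + length y) (degs-take z (b ++ y) v≡zby) ⟩
        degs z + k + length y                 ≡⟨ +-assoc (degs z) k (length y) ⟩
        degs z + (k + length y)               ≡⟨ cong (λ i → degs z + i) balance ⟨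
        degs z + (degs x + degs y + 1)        ≡⟨ regroup′ (degs x) (degs y) (degs z) ⟩
        degs x + 1 + (degs y + degs z)        ∎))
      where
      open ≤-Reasoning
      regroup : ∀ a b c → a + 1 + (b + c) ≡ suc (a + c) + b
      regroup = solve-∀
      regroup′ : ∀ a b c → c + (a + b + 1) ≡ a + 1 + (b + c)
      regroup′ = solve-∀
      t : ℕ
      t = length z
      v≡zby : v ≡ z ++ (b ++ y)
      v≡zby = trans v≡xy (trans (cong (_++ y) x≡zb) (++-assoc z b y))
      1≤t : 1 ≤ t
      1≤t = ≢-[]⇒1≤length z≢[]
      t<k : t < k
      t<k = subst (t <_) (trans (sym (length-++ z)) (trans (cong length (sym x≡zb)) |x|≡k))
                  (m<m+n t (≢-[]⇒1≤length b≢[]))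

    rotated-Łuk : Łuk 1 (y ++ x)
    rotated-Łuk = criterion⇒Łuk 1 (y ++ x) (prefixes , whole)
      where
      whole : 1 + degs (y ++ x) ≡ length (y ++ x)
      whole = trans (+-comm 1 _) (Balanced-rotate x y (subst Balanced v≡xy bal))
      bounded-prefix : ∀ {a a′} → a′ ≡ a → length a ≤ degs a → length a′ < 1 + degs a′
      bounded-prefix refl le = s≤s le
      prefixes : ∀ a b → y ++ x ≡ a ++ b → b ≢ [] → length a < 1 + degs a
      prefixes a b eq b≢[] with ++-split a b y x (sym eq)
      ... | inj₁ (z , y≡az , _) = s≤s (tail-prefix-bound a z y≡az)
      ... | inj₂ ([] , a≡y , _) =
        bounded-prefix (trans a≡y (++-identityʳ y)) (tail-prefix-bound y [] (sym (++-identityʳ y)))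
      ... | inj₂ (z@(_ ∷ _) , a≡yz , x≡zb) = bounded-prefix a≡yz (head-prefix-bound z b x≡zb (λ ()) b≢[])

  rotation-exists : ∀ v → v ≢ [] → Balanced v → ŁukRotation v
  rotation-exists []         v≢[] _   = ⊥-elim (v≢[] refl)
  rotation-exists v@(_ ∷ v′) _    bal = x , y , v≡xy , x≢[] , rotated-Łuk
    where open RotationAtFirstMinimiser v bal (proj₂ (first-minimiser (λ t → degs (take t v)) (length v′)))

  ŁukWords : (List A → Set) → ℕ → Set
  ŁukWords P j = Σ (List A) λ w → (Łuk 1 w × length w ≡ j) × P w

  BalancedWords : (List A → Set) → ℕ → Set
  BalancedWords P j = Σ (List A) λ v → length v ≡ j × Balanced v × P v

  module _ (P : List A → Set) (P-rotate : ∀ xs ys → P (xs ++ ys) → P (ys ++ xs))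
           (P-irrelevant : ∀ w → Irrelevant (P w)) where

    cycle-lemma : ∀ j → (ŁukWords P (suc j) × Fin (suc j)) ↔ BalancedWords P (suc j)
    cycle-lemma j = mk↔ₛ′ rotate unrotate rotate∘unrotate unrotate∘rotate
      where
      rotate : ŁukWords P (suc j) × Fin (suc j) → BalancedWords P (suc j)
      rotate ((w , (p , |w|) , Pw) , m) =
        b ++ a , trans (length-++-comm b a) (trans (cong length ab≡w) |w|) ,
                 Balanced-rotate a b (subst Balanced (sym ab≡w) (Łuk⇒Balanced p)) ,
                 P-rotate a b (subst P (sym ab≡w) Pw)
        where
        a b : List A
        a = take (toℕ m) w
        b = drop (toℕ m) w
        ab≡w : a ++ b ≡ w
        ab≡w = take++drop≡id (toℕ m) w

      rotation : (v : BalancedWords P (suc j)) → ŁukRotation (proj₁ v)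
      rotation (v , |v| , bal , _) = rotation-exists v (λ { refl → 0≢1+n |v| }) bal

      unrotate′ : (v : BalancedWords P (suc j)) → ŁukRotation (proj₁ v) → ŁukWords P (suc j) × Fin (suc j)
      unrotate′ (v , |v| , _ , Pv) (x , y , v≡xy , x≢[] , p) =
        (y ++ x , (p , |yx|) , P-rotate x y (subst P v≡xy Pv)) , fromℕ< |y|<suc-j
        where
        |yx| : length (y ++ x) ≡ suc j
        |yx| = trans (length-++-comm y x) (trans (cong length (sym v≡xy)) |v|)
        |y|<suc-j : length y < suc j
        |y|<suc-j = subst (length y <_) (trans (sym (length-++ y)) |yx|) (m<m+n (length y) (≢-[]⇒1≤length x≢[]))

      unrotate : BalancedWords P (suc j) → ŁukWords P (suc j) × Fin (suc j)
      unrotate v = unrotate′ v (rotation v)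

      rotate∘unrotate : ∀ v → rotate (unrotate v) ≡ v
      rotate∘unrotate bw@(v , _ , _ , _) = go (rotation bw)
        where
        go : ∀ r → rotate (unrotate′ bw r) ≡ bw
        go r@(x , y , v≡xy , _ , _) = Σ-≡-irrelevant
          (λ v → ×-irrelevant uip (×-irrelevant uip (P-irrelevant v)))
          (begin
            drop m (y ++ x) ++ take m (y ++ x)
              ≡⟨ cong (λ i → drop i (y ++ x) ++ take i (y ++ x)) m≡|y| ⟩
            drop (length y) (y ++ x) ++ take (length y) (y ++ x)
              ≡⟨ cong₂ _++_ (drop-length-++ y x) (take-length-++ y x) ⟩
            x ++ y
              ≡⟨ v≡xy ⟨
            v ∎)
          where
          open ≡-Reasoning
          m : ℕ
          m = toℕ (proj₂ (unrotate′ bw r))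
          m≡|y| : m ≡ length y
          m≡|y| = toℕ-fromℕ< _

      unrotate∘rotate : ∀ a → unrotate (rotate a) ≡ a
      unrotate∘rotate a@((w , (p , |w|) , Pw) , m) = go (rotation (rotate a))
        where
        u b : List A
        u = take (toℕ m) w
        b = drop (toℕ m) w
        ub≡w : u ++ b ≡ w
        ub≡w = take++drop≡id (toℕ m) w
        m<|w| : toℕ m < length w
        m<|w| = subst (toℕ m <_) (sym |w|) (toℕ<n m)
        |u|≡m : length u ≡ toℕ m
        |u|≡m = trans (length-take (toℕ m) w) (m≤n⇒m⊓n≡m (<⇒≤ m<|w|))
        b≢[] : b ≢ []
        b≢[] b≡[] = <⇒≱ m<|w| (m∸n≡0⇒m≤n (trans (sym (length-drop (toℕ m) w)) (cong length b≡[])))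
        go : ∀ r → unrotate′ (rotate a) r ≡ a
        go (x , y , bu≡xy , x≢[] , q)
          with rotation-unique b u x y bu≡xy b≢[] x≢[] (subst (Łuk 1) (sym ub≡w) p) q
        ... | refl , refl = cong₂ _,_
          (Σ-≡-irrelevant (λ w → ×-irrelevant (×-irrelevant Łuk-irrelevant uip) (P-irrelevant w)) ub≡w)
          (toℕ-injective (trans (toℕ-fromℕ< _) |u|≡m))

-- Ordered trees as Łukasiewicz words

-- A letter is the sequence of leaf flags of the children of an internal node.
Letter : Set
Letter = Bool × List Bool

flags : Letter → List Bool
flags (b , bs) = b ∷ bs

#false : List Bool → ℕ
#false []          = 0
#false (true ∷ bs)  = #false bs
#false (false ∷ bs) = suc (#false bs)

#internal #children #unprotected : Letter → ℕ
#internal w    = #false (flags w)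
#children w    = length (flags w)
#unprotected w = if or (flags w) then 1 else 0

open Łukasiewicz #internal

#internalTrees : List Tree → ℕ
#internalTrees ts = #false (map isLeaf ts)

mutual
  encode : Tree → List Letter
  encode (node [])       = []
  encode (node (c ∷ cs)) = (isLeaf c , map isLeaf cs) ∷ encodeForest (c ∷ cs)

  encodeForest : List Tree → List Letter
  encodeForest []       = []
  encodeForest (t ∷ ts) = encode t ++ encodeForest ts

encodeForest-++ : ∀ ts us → encodeForest (ts ++ us) ≡ encodeForest ts ++ encodeForest us
encodeForest-++ []       us = refl
encodeForest-++ (t ∷ ts) us =
  trans (cong (encode t ++_) (encodeForest-++ ts us)) (sym (++-assoc (encode t) (encodeForest ts) (encodeForest us)))

-- Stated for every l′ ≡ encode t ++ l so that the associativity of ++ needs no transport.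
mutual
  encode-Łuk : ∀ t {r l l′} → l′ ≡ encode t ++ l → Łuk r l → Łuk (#internalTrees (t ∷ []) + r) l′
  encode-Łuk (node [])       refl p = p
  encode-Łuk (node (c ∷ cs)) refl p = step _ (encodeForest-Łuk (c ∷ cs) refl p)

  encodeForest-Łuk : ∀ ts {r l l′} → l′ ≡ encodeForest ts ++ l → Łuk r l → Łuk (#internalTrees ts + r) l′
  encodeForest-Łuk []                   refl p = p
  encodeForest-Łuk (node [] ∷ ts)       refl p = encodeForest-Łuk ts refl p
  encodeForest-Łuk (t@(node (_ ∷ _)) ∷ ts) {l = l} refl p =
    encode-Łuk t (++-assoc (encode t) (encodeForest ts) l) (encodeForest-Łuk ts refl p)

fill : (w : List Bool) → Vec Tree (#false w) → List Tree
fill []           []       = []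
fill (true ∷ w)   ts       = node [] ∷ fill w ts
fill (false ∷ w)  (t ∷ ts) = t ∷ fill w ts

decode : ∀ {r l} → Łuk r l → Vec Tree r
decode done       = []
decode (step w p) = node (fill (flags w) (Vec.take (#internal w) (decode p))) ∷ Vec.drop (#internal w) (decode p)

Internal : Tree → Set
Internal t = isLeaf t ≡ false

take-++ᵛ : {A : Set} {m n : ℕ} (xs : Vec A m) (ys : Vec A n) → Vec.take m (xs ++ᵛ ys) ≡ xs
take-++ᵛ []       ys = refl
take-++ᵛ (x ∷ xs) ys = cong (x ∷_) (take-++ᵛ xs ys)

drop-++ᵛ : {A : Set} {m n : ℕ} (xs : Vec A m) (ys : Vec A n) → Vec.drop m (xs ++ᵛ ys) ≡ ys
drop-++ᵛ []       ys = refl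
drop-++ᵛ (x ∷ xs) ys = drop-++ᵛ xs ys

All-take : ∀ {P : Tree → Set} m {n} (ts : Vec Tree (m + n)) → All P ts → All P (Vec.take m ts)
All-take zero    ts       _        = []
All-take (suc m) (t ∷ ts) (p ∷ ps) = p ∷ All-take m ts ps

All-drop : ∀ {P : Tree → Set} m {n} (ts : Vec Tree (m + n)) → All P ts → All P (Vec.drop m ts)
All-drop zero    ts       ps       = ps
All-drop (suc m) (t ∷ ts) (p ∷ ps) = All-drop m ts ps

node-fill-Internal : ∀ b bs ts → Internal (node (fill (b ∷ bs) ts))
node-fill-Internal true  bs ts      = refl
node-fill-Internal false bs (_ ∷ _) = refl

decode-Internal : ∀ {r l} (p : Łuk r l) → All Internal (decode p)
decode-Internal done                = []
decode-Internal (step w@(b , bs) p) =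
  node-fill-Internal b bs _ ∷ All-drop (#internal w) (decode p) (decode-Internal p)

map-isLeaf-fill : ∀ w ts → All Internal ts → map isLeaf (fill w ts) ≡ w
map-isLeaf-fill []          []       []       = refl
map-isLeaf-fill (true ∷ w)  ts       ps       = cong (true ∷_) (map-isLeaf-fill w ts ps)
map-isLeaf-fill (false ∷ w) (t ∷ ts) (p ∷ ps) = cong₂ _∷_ p (map-isLeaf-fill w ts ps)

encodeForest-fill : ∀ w ts → encodeForest (fill w ts) ≡ encodeForest (toList ts)
encodeForest-fill []          []       = refl
encodeForest-fill (true ∷ w)  ts       = encodeForest-fill w ts
encodeForest-fill (false ∷ w) (t ∷ ts) = cong (encode t ++_) (encodeForest-fill w ts)

encode-node : ∀ w cs → map isLeaf cs ≡ flags w → encode (node cs) ≡ w ∷ encodeForest cs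
encode-node (.(isLeaf c) , .(map isLeaf cs)) (c ∷ cs) refl = refl

encode-decode : ∀ {r l} (p : Łuk r l) → encodeForest (toList (decode p)) ≡ l
encode-decode done = refl
encode-decode {suc r} (step w p) = begin
  encode (node cs) ++ encodeForest (toList rest)
    ≡⟨ cong (_++ encodeForest (toList rest)) (encode-node w cs flags-cs) ⟩
  w ∷ (encodeForest cs ++ encodeForest (toList rest))
    ≡⟨ cong (λ e → w ∷ (e ++ encodeForest (toList rest))) (encodeForest-fill (flags w) children) ⟩
  w ∷ (encodeForest (toList children) ++ encodeForest (toList rest))
    ≡⟨ cong (w ∷_) (encodeForest-++ (toList children) (toList rest)) ⟨
  w ∷ encodeForest (toList children ++ toList rest)
    ≡⟨ cong (λ ts → w ∷ encodeForest ts) (toList-++ children rest) ⟨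
  w ∷ encodeForest (toList (children ++ᵛ rest))
    ≡⟨ cong (λ ts → w ∷ encodeForest (toList ts)) (take++drop≡idᵛ (#internal w) (decode p)) ⟩
  w ∷ encodeForest (toList (decode p))
    ≡⟨ cong (w ∷_) (encode-decode p) ⟩
  w ∷ _
    ∎
  where
  open ≡-Reasoning
  children : Vec Tree (#internal w)
  children = Vec.take (#internal w) (decode p)
  rest : Vec Tree r
  rest = Vec.drop (#internal w) (decode p)
  cs : List Tree
  cs = fill (flags w) children
  flags-cs : map isLeaf cs ≡ flags w
  flags-cs = map-isLeaf-fill (flags w) children (All-take (#internal w) (decode p) (decode-Internal p))

internals : (ts : List Tree) → Vec Tree (#internalTrees ts)
internals []                      = []
internals (node [] ∷ ts)          = internals ts
internals (t@(node (_ ∷ _)) ∷ ts) = t ∷ internals ts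

fill-internals : ∀ ts → fill (map isLeaf ts) (internals ts) ≡ ts
fill-internals []                      = refl
fill-internals (node [] ∷ ts)          = cong (node [] ∷_) (fill-internals ts)
fill-internals (t@(node (_ ∷ _)) ∷ ts) = cong (t ∷_) (fill-internals ts)

mutual
  decode-encode : ∀ t {r l l′} (eq : l′ ≡ encode t ++ l) (p : Łuk r l) (q : Łuk (#internalTrees (t ∷ []) + r) l′) →
                  decode q ≡ internals (t ∷ []) ++ᵛ decode p
  decode-encode (node [])          refl p q = cong decode (Łuk-irrelevant q p)
  decode-encode t@(node cs@(_ ∷ _)) refl p (step w q) = begin
    node (fill (flags w) (Vec.take d (decode q))) ∷ Vec.drop d (decode q)
      ≡⟨ cong (λ ts → node (fill (flags w) (Vec.take d ts)) ∷ Vec.drop d ts) (decodeForest-encode cs refl p q) ⟩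
    node (fill (flags w) (Vec.take d (internals cs ++ᵛ decode p))) ∷ Vec.drop d (internals cs ++ᵛ decode p)
      ≡⟨ cong₂ (λ ts us → node (fill (flags w) ts) ∷ us)
               (take-++ᵛ (internals cs) (decode p)) (drop-++ᵛ (internals cs) (decode p)) ⟩
    node (fill (map isLeaf cs) (internals cs)) ∷ decode p
      ≡⟨ cong (λ us → node us ∷ decode p) (fill-internals cs) ⟩
    t ∷ decode p ∎
    where
    open ≡-Reasoning
    d : ℕ
    d = #internalTrees cs

  decodeForest-encode : ∀ ts {r l l′} (eq : l′ ≡ encodeForest ts ++ l) (p : Łuk r l) (q : Łuk (#internalTrees ts + r) l′) →
                        decode q ≡ internals ts ++ᵛ decode p
  decodeForest-encode []                      refl p q = cong decode (Łuk-irrelevant q p)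
  decodeForest-encode (node [] ∷ ts)          refl p q = decodeForest-encode ts refl p q
  decodeForest-encode (t@(node (_ ∷ _)) ∷ ts) {l = l} refl p q =
    trans (decode-encode t (++-assoc (encode t) (encodeForest ts) l) (encodeForest-Łuk ts refl p) q)
          (cong (t ∷_) (decodeForest-encode ts refl p (encodeForest-Łuk ts refl p)))

Stats : ℕ → ℕ → List Letter → Set
Stats n s l = total #children l ≡ n × total #unprotected l ≡ s

mutual
  edges-encode : ∀ t → edges t ≡ total #children (encode t)
  edges-encode (node [])       = refl
  edges-encode (node (c ∷ cs)) =
    trans (edgesF-encode (c ∷ cs)) (cong (λ k → suc k + total #children (encodeForest (c ∷ cs))) (sym (length-map isLeaf cs)))

  edgesF-encode : ∀ ts → edgesF ts ≡ length ts + total #children (encodeForest ts)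
  edgesF-encode []       = refl
  edgesF-encode (t ∷ ts) = cong suc (begin
    edges t + edgesF ts
      ≡⟨ cong₂ _+_ (edges-encode t) (edgesF-encode ts) ⟩
    E (encode t) + (length ts + E (encodeForest ts))
      ≡⟨ exchange (E (encode t)) (length ts) _ ⟩
    length ts + (E (encode t) + E (encodeForest ts))
      ≡⟨ cong (λ k → length ts + k) (total-++ #children (encode t) _) ⟨
    length ts + E (encode t ++ encodeForest ts) ∎)
    where
    open ≡-Reasoning
    E : List Letter → ℕ
    E = total #children
    exchange : ∀ a b c → a + (b + c) ≡ b + (a + c)
    exchange = solve-∀

someLeaf≡or : ∀ ts → someLeaf ts ≡ or (map isLeaf ts)
someLeaf≡or []       = refl
someLeaf≡or (t ∷ ts) = cong (isLeaf t ∨_) (someLeaf≡or ts)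

mutual
  unprotected-encode : ∀ t → unprotected t ≡ total #unprotected (encode t)
  unprotected-encode (node [])          = refl
  unprotected-encode (node cs@(_ ∷ _)) =
    cong₂ _+_ (cong (λ b → if b then 1 else 0) (someLeaf≡or cs)) (unprotectedF-encode cs)

  unprotectedF-encode : ∀ ts → unprotectedF ts ≡ total #unprotected (encodeForest ts)
  unprotectedF-encode []       = refl
  unprotectedF-encode (t ∷ ts) =
    trans (cong₂ _+_ (unprotected-encode t) (unprotectedF-encode ts)) (sym (total-++ #unprotected (encode t) _))

Trees : ℕ → ℕ → Set
Trees n s = Σ Tree (λ t → edges t ≡ n × unprotected t ≡ s)

ŁukCodes : ℕ → ℕ → Set
ŁukCodes n s = Σ (List Letter) (λ l → Łuk 1 l × Stats n s l)

Trees↔ŁukCodes : ∀ n s → Trees (suc n) s ↔ ŁukCodes (suc n) s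
Trees↔ŁukCodes n s = mk↔ₛ′ to from to∘from from∘to
  where
  encode-Łuk₁ : ∀ t → Internal t → Łuk 1 (encode t)
  encode-Łuk₁ t@(node (_ ∷ _)) refl = encode-Łuk t (sym (++-identityʳ (encode t))) done

  to : Trees (suc n) s → ŁukCodes (suc n) s
  to (node [] , () , _)
  to (t@(node (_ ∷ _)) , e , u) =
    encode t , encode-Łuk₁ t refl , trans (sym (edges-encode t)) e , trans (sym (unprotected-encode t)) u

  root : ∀ {l} → Łuk 1 l → Tree
  root p = Vec.head (decode p)

  encode-root : ∀ {l} (p : Łuk 1 l) → encode (root p) ≡ l
  encode-root p with decode p | encode-decode p
  ... | t ∷ [] | encoded = trans (sym (++-identityʳ (encode t))) encoded

  root-Internal : ∀ {l} (p : Łuk 1 l) → Internal (root p)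
  root-Internal p with decode p | decode-Internal p
  ... | t ∷ [] | i ∷ [] = i

  from : ŁukCodes (suc n) s → Trees (suc n) s
  from (l , p , e , u) = root p ,
    trans (edges-encode (root p)) (trans (cong (total #children) (encode-root p)) e) ,
    trans (unprotected-encode (root p)) (trans (cong (total #unprotected) (encode-root p)) u)

  to-encode : ∀ t e u → Internal t → proj₁ (to (t , e , u)) ≡ encode t
  to-encode (node (_ ∷ _)) e u _ = refl

  to∘from : ∀ c → to (from c) ≡ c
  to∘from (l , p , e , u) = Σ-≡-irrelevant (λ _ → ×-irrelevant Łuk-irrelevant (×-irrelevant uip uip))
    (trans (to-encode _ _ _ (root-Internal p)) (encode-root p))

  from∘to : ∀ t → from (to t) ≡ t
  from∘to (node [] , () , _)
  from∘to (t@(node (_ ∷ _)) , e , u) = Σ-≡-irrelevant (λ _ → ×-irrelevant uip uip)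
    (cong Vec.head (decode-encode t (sym (++-identityʳ (encode t))) done (encode-Łuk₁ t refl)))

-- Counting balanced words

fromList-of-length : {A : Set} {j : ℕ} (xs : List A) → length xs ≡ j → Vec A j
fromList-of-length {j = zero}  []       _ = []
fromList-of-length {j = suc j} (x ∷ xs) e = x ∷ fromList-of-length xs (suc-injective e)

toList-fromList-of-length : {A : Set} {j : ℕ} (xs : List A) (e : length xs ≡ j) → toList (fromList-of-length xs e) ≡ xs
toList-fromList-of-length {j = zero}  []       _ = refl
toList-fromList-of-length {j = suc j} (x ∷ xs) e = cong (x ∷_) (toList-fromList-of-length xs (suc-injective e))

fromList-of-length-toList : {A : Set} {j : ℕ} (v : Vec A j) (e : length (toList v) ≡ j) → fromList-of-length (toList v) e ≡ v
fromList-of-length-toList []       _ = refl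
fromList-of-length-toList (x ∷ v) e = cong (x ∷_) (fromList-of-length-toList v (suc-injective e))

Σ-List-of-length↔Vec : {A : Set} (P : List A → Set) → (∀ xs → Irrelevant (P xs)) → ∀ j →
                       Σ (List A) (λ xs → length xs ≡ j × P xs) ↔ Σ (Vec A j) (λ v → P (toList v))
Σ-List-of-length↔Vec P P-irrelevant j = mk↔ₛ′
  (λ (xs , e , p) → fromList-of-length xs e , subst P (sym (toList-fromList-of-length xs e)) p)
  (λ (v , p) → toList v , length-toList v , p)
  (λ (v , p) → Σ-≡-irrelevant (λ v → P-irrelevant (toList v)) (fromList-of-length-toList v (length-toList v)))
  (λ (xs , e , p) → Σ-≡-irrelevant (λ xs → ×-irrelevant uip (P-irrelevant xs)) (toList-fromList-of-length xs e))

-- Every letter is false^a followed either by one more false or by true and a tail τ.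
letter : ℕ → Maybe (List Bool) → Letter
letter a       nothing  = false , replicate a false
letter zero    (just τ) = true , τ
letter (suc a) (just τ) = false , (replicate a false ++ true ∷ τ)

split-flags : List Bool → ℕ × Maybe (List Bool)
split-flags []           = 0 , nothing
split-flags (true ∷ τ)   = 0 , just τ
split-flags (false ∷ bs) with split-flags bs
... | a , m = suc a , m

split-letter : Letter → ℕ × Maybe (List Bool)
split-letter (true , τ) = 0 , just τ
split-letter (false , bs) with split-flags bs
... | a , nothing = a , nothing
... | a , just τ  = suc a , just τ

data SplitFlags : List Bool → ℕ × Maybe (List Bool) → Set where
  all-false  : ∀ a → SplitFlags (replicate a false) (a , nothing)
  first-true : ∀ a τ → SplitFlags (replicate a false ++ true ∷ τ) (a , just τ)

split-flags-correct : ∀ bs → SplitFlags bs (split-flags bs)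
split-flags-correct []         = all-false 0
split-flags-correct (true ∷ τ) = first-true 0 τ
split-flags-correct (false ∷ bs) with split-flags bs | split-flags-correct bs
... | _ | all-false a    = all-false (suc a)
... | _ | first-true a τ = first-true (suc a) τ

split-flags-all-false : ∀ a → split-flags (replicate a false) ≡ (a , nothing)
split-flags-all-false zero                                  = refl
split-flags-all-false (suc a) rewrite split-flags-all-false a = refl

split-flags-first-true : ∀ a τ → split-flags (replicate a false ++ true ∷ τ) ≡ (a , just τ)
split-flags-first-true zero    τ                                    = refl
split-flags-first-true (suc a) τ rewrite split-flags-first-true a τ = refl

split-letter-letter : ∀ a m → split-letter (letter a m) ≡ (a , m)
split-letter-letter a       nothing  rewrite split-flags-all-false a    = refl
split-letter-letter zero    (just τ)                                    = refl
split-letter-letter (suc a) (just τ) rewrite split-flags-first-true a τ = refl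

letter-split-letter : ∀ w → letter (proj₁ (split-letter w)) (proj₂ (split-letter w)) ≡ w
letter-split-letter (true , τ) = refl
letter-split-letter (false , bs) with split-flags bs | split-flags-correct bs
... | _ | all-false a    = refl
... | _ | first-true a τ = refl

hasTail : Maybe (List Bool) → ℕ
hasTail nothing  = 0
hasTail (just _) = 1

tailStat : (List Bool → ℕ) → Maybe (List Bool) → ℕ
tailStat f nothing  = 0
tailStat f (just τ) = f τ

#false-replicate : ∀ a → #false (replicate a false) ≡ a
#false-replicate zero    = refl
#false-replicate (suc a) = cong suc (#false-replicate a)

#false-first-true : ∀ a τ → #false (replicate a false ++ true ∷ τ) ≡ a + #false τ
#false-first-true zero    τ = refl
#false-first-true (suc a) τ = cong suc (#false-first-true a τ)

length-first-true : ∀ a τ → length (replicate a false ++ true ∷ τ) ≡ a + suc (length τ)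
length-first-true zero    τ = refl
length-first-true (suc a) τ = cong suc (length-first-true a τ)

or-replicate : ∀ a → or (replicate a false) ≡ false
or-replicate zero    = refl
or-replicate (suc a) = or-replicate a

or-first-true : ∀ a τ → or (replicate a false ++ true ∷ τ) ≡ true
or-first-true zero    τ = refl
or-first-true (suc a) τ = or-first-true a τ

#internal-letter : ∀ a m → #internal (letter a m) + hasTail m ≡ suc a + tailStat #false m
#internal-letter a       nothing  = trans (+-identityʳ _) (cong suc (trans (#false-replicate a) (sym (+-identityʳ a))))
#internal-letter zero    (just τ) = +-comm (#false τ) 1
#internal-letter (suc a) (just τ) = trans (+-comm (suc (#false (replicate a false ++ true ∷ τ))) 1)
                                          (cong (λ k → suc (suc k)) (#false-first-true a τ))

#children-letter : ∀ a m → #children (letter a m) ≡ suc a + tailStat length m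
#children-letter a       nothing  = cong suc (trans (length-replicate a) (sym (+-identityʳ a)))
#children-letter zero    (just τ) = refl
#children-letter (suc a) (just τ) = cong suc (trans (length-first-true a τ) (+-suc a (length τ)))

#unprotected-letter : ∀ a m → #unprotected (letter a m) ≡ hasTail m
#unprotected-letter a       nothing  = cong (λ b → if b then 1 else 0) (or-replicate a)
#unprotected-letter zero    (just τ) = refl
#unprotected-letter (suc a) (just τ) = cong (λ b → if b then 1 else 0) (or-first-true a τ)

#true : ∀ {j} → Vec Bool j → ℕ
#true []          = 0
#true (true ∷ p)  = suc (#true p)
#true (false ∷ p) = #true p

-- A word of j letters through letter: the counts a, which letters carry a tail, and the tails.
Parts : ℕ → Set
Parts j = Σ (Vec ℕ j) λ α → Σ (Vec Bool j) λ p → Vec (List Bool) (#true p)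

assemble : ∀ {j} → Parts j → Vec Letter j
assemble ([]    , []        , [])    = []
assemble (a ∷ α , false ∷ p , τ)     = letter a nothing ∷ assemble (α , p , τ)
assemble (a ∷ α , true ∷ p  , t ∷ τ) = letter a (just t) ∷ assemble (α , p , τ)

cons-part : ∀ {j} → ℕ × Maybe (List Bool) → Parts j → Parts (suc j)
cons-part (a , nothing) (α , p , τ) = a ∷ α , false ∷ p , τ
cons-part (a , just t)  (α , p , τ) = a ∷ α , true ∷ p , t ∷ τ

disassemble : ∀ {j} → Vec Letter j → Parts j
disassemble []      = [] , [] , []
disassemble (w ∷ v) = cons-part (split-letter w) (disassemble v)

assemble-cons-part : ∀ {j} am (d : Parts j) → assemble (cons-part am d) ≡ letter (proj₁ am) (proj₂ am) ∷ assemble d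
assemble-cons-part (a , nothing) _ = refl
assemble-cons-part (a , just t)  _ = refl

Vec-Letter↔Parts : ∀ j → Vec Letter j ↔ Parts j
Vec-Letter↔Parts j = mk↔ₛ′ disassemble assemble disassemble-assemble assemble-disassemble
  where
  assemble-disassemble : ∀ {j} (v : Vec Letter j) → assemble (disassemble v) ≡ v
  assemble-disassemble []      = refl
  assemble-disassemble (w ∷ v) =
    trans (assemble-cons-part (split-letter w) (disassemble v)) (cong₂ _∷_ (letter-split-letter w) (assemble-disassemble v))
  disassemble-assemble : ∀ {j} (d : Parts j) → disassemble (assemble d) ≡ d
  disassemble-assemble ([] , [] , []) = refl
  disassemble-assemble (a ∷ α , false ∷ p , τ)
    rewrite split-letter-letter a nothing | disassemble-assemble (α , p , τ) = refl
  disassemble-assemble (a ∷ α , true ∷ p , t ∷ τ)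
    rewrite split-letter-letter a (just t) | disassemble-assemble (α , p , τ) = refl

degs-assemble : ∀ {j} α p τ → degs (toList (assemble {j} (α , p , τ))) + #true p ≡ Vec.sum α + j + total #false (toList τ)
degs-assemble []      []        []      = refl
degs-assemble {suc j} (a ∷ α) (false ∷ p) τ = begin
  #internal (letter a nothing) + D + #true p
    ≡⟨ regroup (#internal (letter a nothing)) D (#true p) ⟩
  (#internal (letter a nothing) + 0) + (D + #true p)
    ≡⟨ cong₂ _+_ (#internal-letter a nothing) (degs-assemble α p τ) ⟩
  suc a + 0 + (Vec.sum α + j + total #false (toList τ))
    ≡⟨ regroup′ a (Vec.sum α) j (total #false (toList τ)) ⟩
  a + Vec.sum α + suc j + total #false (toList τ) ∎
  where
  open ≡-Reasoning
  D : ℕ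
  D = degs (toList (assemble (α , p , τ)))
  regroup : ∀ x y z → x + y + z ≡ (x + 0) + (y + z)
  regroup = solve-∀
  regroup′ : ∀ a b j t → suc a + 0 + (b + j + t) ≡ a + b + suc j + t
  regroup′ = solve-∀
degs-assemble {suc j} (a ∷ α) (true ∷ p) (t ∷ τ) = begin
  #internal (letter a (just t)) + D + suc (#true p)
    ≡⟨ regroup (#internal (letter a (just t))) D (#true p) ⟩
  (#internal (letter a (just t)) + 1) + (D + #true p)
    ≡⟨ cong₂ _+_ (#internal-letter a (just t)) (degs-assemble α p τ) ⟩
  suc a + #false t + (Vec.sum α + j + total #false (toList τ))
    ≡⟨ regroup′ a (Vec.sum α) j (total #false (toList τ)) (#false t) ⟩
  a + Vec.sum α + suc j + (#false t + total #false (toList τ)) ∎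
  where
  open ≡-Reasoning
  D : ℕ
  D = degs (toList (assemble (α , p , τ)))
  regroup : ∀ x y z → x + y + suc z ≡ (x + 1) + (y + z)
  regroup = solve-∀
  regroup′ : ∀ a b j t c → suc a + c + (b + j + t) ≡ a + b + suc j + (c + t)
  regroup′ = solve-∀

#children-assemble : ∀ {j} α p τ → total #children (toList (assemble {j} (α , p , τ))) ≡ Vec.sum α + j + total length (toList τ)
#children-assemble []      []        []      = refl
#children-assemble {suc j} (a ∷ α) (false ∷ p) τ =
  trans (cong₂ _+_ (#children-letter a nothing) (#children-assemble α p τ)) (regroup a (Vec.sum α) j _)
  where
  regroup : ∀ a b j t → suc a + 0 + (b + j + t) ≡ a + b + suc j + t
  regroup = solve-∀
#children-assemble {suc j} (a ∷ α) (true ∷ p) (t ∷ τ) =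
  trans (cong₂ _+_ (#children-letter a (just t)) (#children-assemble α p τ)) (regroup a (Vec.sum α) j _ (length t))
  where
  regroup : ∀ a b j t c → suc a + c + (b + j + t) ≡ a + b + suc j + (c + t)
  regroup = solve-∀

#unprotected-assemble : ∀ {j} α p τ → total #unprotected (toList (assemble {j} (α , p , τ))) ≡ #true p
#unprotected-assemble []      []          []      = refl
#unprotected-assemble (a ∷ α) (false ∷ p) τ       =
  cong₂ _+_ (#unprotected-letter a nothing) (#unprotected-assemble α p τ)
#unprotected-assemble (a ∷ α) (true ∷ p)  (t ∷ τ) =
  cong₂ _+_ (#unprotected-letter a (just t)) (#unprotected-assemble α p τ)

PartsConstraint : ℕ → ℕ → ∀ j → Parts j → Set
PartsConstraint n s j (α , p , τ) =
  #true p ≡ s × Vec.sum α + total #false (toList τ) + 1 ≡ s × Vec.sum α + j + total length (toList τ) ≡ n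

balance⇒tails : ∀ D c a j t → D + c ≡ a + j + t → D + 1 ≡ j → a + t + 1 ≡ c
balance⇒tails D c a j t e refl = sym (+-cancelˡ-≡ D c (a + t + 1) (trans e (regroup D a t)))
  where
  regroup : ∀ D a t → a + (D + 1) + t ≡ D + (a + t + 1)
  regroup = solve-∀

tails⇒balance : ∀ D c a j t → D + c ≡ a + j + t → a + t + 1 ≡ c → D + 1 ≡ j
tails⇒balance D c a j t e refl = +-cancelʳ-≡ (a + t) (D + 1) j (trans (regroup D a t) (trans e (regroup′ a j t)))
  where
  regroup : ∀ D a t → D + 1 + (a + t) ≡ D + (a + t + 1)
  regroup = solve-∀
  regroup′ : ∀ a j t → a + j + t ≡ j + (a + t)
  regroup′ = solve-∀

BalancedWords↔Parts : ∀ n s j →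
  BalancedWords (Stats n s) j ↔ Σ (Parts j) (PartsConstraint n s j)
BalancedWords↔Parts n s j = ↔-trans
  (Σ-List-of-length↔Vec (λ v → Balanced v × Stats n s v) (λ _ → ×-irrelevant uip (×-irrelevant uip uip)) j)
  (Σ-↔-irrelevant (Vec-Letter↔Parts j) (λ _ → ×-irrelevant uip (×-irrelevant uip uip))
    (λ _ → ×-irrelevant uip (×-irrelevant uip uip)) to-constraint from-constraint)
  where
  to-constraint′ : ∀ d → Balanced (toList (assemble d)) × Stats n s (toList (assemble d)) → PartsConstraint n s j d
  to-constraint′ (α , p , τ) (bal , e , u) =
    #true≡s , trans (balance⇒tails _ _ (Vec.sum α) j (total #false (toList τ)) (degs-assemble α p τ) degs+1≡j) #true≡s ,
    trans (sym (#children-assemble α p τ)) e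
    where
    degs+1≡j : degs (toList (assemble (α , p , τ))) + 1 ≡ j
    degs+1≡j = trans bal (length-toList (assemble (α , p , τ)))
    #true≡s : #true p ≡ s
    #true≡s = trans (sym (#unprotected-assemble α p τ)) u
  to-constraint : ∀ v → Balanced (toList v) × Stats n s (toList v) → PartsConstraint n s j (disassemble v)
  to-constraint v c = to-constraint′ (disassemble v)
    (subst (λ v → Balanced (toList v) × Stats n s (toList v)) (sym (Inverse.strictlyInverseʳ (Vec-Letter↔Parts j) v)) c)
  from-constraint : ∀ d → PartsConstraint n s j d → Balanced (toList (assemble d)) × Stats n s (toList (assemble d))
  from-constraint (α , p , τ) (#true≡s , tails , e) =
    trans (tails⇒balance _ _ (Vec.sum α) j (total #false (toList τ)) (degs-assemble α p τ) (trans tails (sym #true≡s)))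
          (sym (length-toList (assemble (α , p , τ)))) ,
    trans (#children-assemble α p τ) e , trans (#unprotected-assemble α p τ) #true≡s

Compositions : ℕ → ℕ → Set
Compositions j m = Σ (Vec ℕ j) (λ α → Vec.sum α ≡ m)

Patterns : ℕ → ℕ → Set
Patterns j s = Σ (Vec Bool j) (λ p → #true p ≡ s)

-- Tails of total length n − m − j with s − 1 − m false flags, stated without subtraction.
TailsFor : ℕ → ℕ → ℕ → ℕ → Set
TailsFor n s j m = Σ (Vec (List Bool) s) λ τ → m + total #false (toList τ) + 1 ≡ s × m + j + total length (toList τ) ≡ n

Parts↔Patterns×Compositions×Tails : ∀ n s j →
  Σ (Parts j) (PartsConstraint n s j) ↔ (Patterns j s × Σ (Fin s) (λ m → Compositions j (toℕ m) × TailsFor n s j (toℕ m)))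
Parts↔Patterns×Compositions×Tails n s j = mk↔ₛ′ to from to∘from from∘to
  where
  Split : Set
  Split = Patterns j s × Σ (Fin s) (λ m → Compositions j (toℕ m) × TailsFor n s j (toℕ m))

  bound : ∀ a t s → a + t + 1 ≡ s → a < s
  bound a t s e = subst (a <_) (trans (+-comm 1 (a + t)) e) (s≤s (m≤m+n a t))

  to : Σ (Parts j) (PartsConstraint n s j) → Split
  to ((α , p , τ) , refl , tails , e) =
    (p , refl) , fromℕ< a<s , (α , sym m≡a) ,
    τ , subst (λ m → m + total #false (toList τ) + 1 ≡ #true p) (sym m≡a) tails ,
        subst (λ m → m + j + total length (toList τ) ≡ n) (sym m≡a) e
    where
    a<s : Vec.sum α < #true p
    a<s = bound (Vec.sum α) (total #false (toList τ)) (#true p) tails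
    m≡a : toℕ (fromℕ< a<s) ≡ Vec.sum α
    m≡a = toℕ-fromℕ< a<s

  from : Split → Σ (Parts j) (PartsConstraint n s j)
  from ((p , refl) , m , (α , a≡m) , τ , tails , e) =
    (α , p , τ) , refl ,
    subst (λ m → m + total #false (toList τ) + 1 ≡ #true p) (sym a≡m) tails ,
    subst (λ m → m + j + total length (toList τ) ≡ n) (sym a≡m) e

  to∘from : ∀ x → to (from x) ≡ x
  to∘from ((p , refl) , m , (α , a≡m) , τ , tails , e) = same-split (toℕ-injective (trans (toℕ-fromℕ< _) a≡m))
    where
    same-split : ∀ {m′} → m′ ≡ m → ∀ {a≡m′ tails′ e′} →
                 _≡_ {A = Split} ((p , refl) , m′ , (α , a≡m′) , τ , tails′ , e′)
                                 ((p , refl) , m , (α , a≡m) , τ , tails , e)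
    same-split refl {a≡m′} {tails′} {e′} rewrite uip a≡m′ a≡m | uip tails′ tails | uip e′ e = refl

  from∘to : ∀ x → from (to x) ≡ x
  from∘to ((α , p , τ) , refl , tails , e) =
    Σ-≡-irrelevant (λ _ → ×-irrelevant uip (×-irrelevant uip uip)) refl

↔Fin-cong : {A : Set} {m n : ℕ} → m ≡ n → A ↔ Fin m → A ↔ Fin n
↔Fin-cong refl e = e

nC0≡1 : ∀ n → n C 0 ≡ 1
nC0≡1 n = trans (nCk≡nC[n∸k] (z≤n {n})) (nCn≡1 n)

Patterns↔Fin : ∀ j s → Patterns j s ↔ Fin (j C s)
Patterns↔Fin zero    zero    = Irrelevant⇒↔Fin1 (λ { ([] , refl) ([] , refl) → refl }) ([] , refl)
Patterns↔Fin zero    (suc s) = ¬⇒↔Fin0 (λ { ([] , ()) })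
Patterns↔Fin (suc j) zero    = ↔Fin-cong (trans (nC0≡1 j) (sym (nC0≡1 (suc j)))) (↔-trans drop-false (Patterns↔Fin j zero))
  where
  drop-false : Patterns (suc j) zero ↔ Patterns j zero
  drop-false = mk↔ₛ′ (λ { (false ∷ p , c) → p , c ; (true ∷ p , ()) }) (λ (p , c) → false ∷ p , c)
                     (λ _ → refl) (λ { (false ∷ p , c) → refl ; (true ∷ p , ()) })
Patterns↔Fin (suc j) (suc s) = ↔Fin-cong (nCk+nC[k+1]≡[n+1]C[k+1] j s)
  (↔-trans split-head (⊎-Fin↔Fin (Patterns↔Fin j s) (Patterns↔Fin j (suc s))))
  where
  split-head : Patterns (suc j) (suc s) ↔ (Patterns j s ⊎ Patterns j (suc s))
  split-head = mk↔ₛ′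
    (λ { (true ∷ p , c) → inj₁ (p , suc-injective c) ; (false ∷ p , c) → inj₂ (p , c) })
    (λ { (inj₁ (p , c)) → true ∷ p , cong suc c ; (inj₂ (p , c)) → false ∷ p , c })
    (λ { (inj₁ (p , c)) → cong (λ c → inj₁ (p , c)) (uip _ _) ; (inj₂ _) → refl })
    (λ { (true ∷ p , c) → cong (true ∷ p ,_) (uip _ _) ; (false ∷ p , c) → refl })

#compositions : ℕ → ℕ → ℕ
#compositions zero    zero    = 1
#compositions zero    (suc m) = 0
#compositions (suc j) zero    = #compositions j zero
#compositions (suc j) (suc m) = #compositions j (suc m) + #compositions (suc j) m

Compositions↔Fin : ∀ j m → Compositions j m ↔ Fin (#compositions j m)
Compositions↔Fin zero    zero    = Irrelevant⇒↔Fin1 (λ { ([] , refl) ([] , refl) → refl }) ([] , refl)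
Compositions↔Fin zero    (suc m) = ¬⇒↔Fin0 (λ { ([] , ()) })
Compositions↔Fin (suc j) zero    = ↔-trans drop-zero (Compositions↔Fin j zero)
  where
  drop-zero : Compositions (suc j) zero ↔ Compositions j zero
  drop-zero = mk↔ₛ′ (λ { (zero ∷ α , c) → α , c ; (suc a ∷ α , ()) }) (λ (α , c) → zero ∷ α , c)
                    (λ _ → refl) (λ { (zero ∷ α , c) → refl ; (suc a ∷ α , ()) })
Compositions↔Fin (suc j) (suc m) =
  ↔-trans split-head (⊎-Fin↔Fin (Compositions↔Fin j (suc m)) (Compositions↔Fin (suc j) m))
  where
  split-head : Compositions (suc j) (suc m) ↔ (Compositions j (suc m) ⊎ Compositions (suc j) m)
  split-head = mk↔ₛ′
    (λ { (zero ∷ α , c) → inj₁ (α , c) ; (suc a ∷ α , c) → inj₂ (a ∷ α , suc-injective c) })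
    (λ { (inj₁ (α , c)) → zero ∷ α , c ; (inj₂ (a ∷ α , c)) → suc a ∷ α , cong suc c })
    (λ { (inj₁ _) → refl ; (inj₂ (a ∷ α , c)) → cong (λ c → inj₂ (a ∷ α , c)) (uip _ _) })
    (λ { (zero ∷ α , c) → refl ; (suc a ∷ α , c) → cong (suc a ∷ α ,_) (uip _ _) })

Tails : ℕ → ℕ → ℕ → Set
Tails s M F = Σ (Vec (List Bool) s) (λ τ → total length (toList τ) ≡ M × total #false (toList τ) ≡ F)

#tails : ℕ → ℕ → ℕ → ℕ
#tails zero    zero    zero    = 1
#tails zero    zero    (suc F) = 0
#tails zero    (suc M) F       = 0
#tails (suc s) zero    F       = #tails s zero F
#tails (suc s) (suc M) zero    = #tails s (suc M) zero + #tails (suc s) M zero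
#tails (suc s) (suc M) (suc F) = #tails s (suc M) (suc F) + (#tails (suc s) M (suc F) + #tails (suc s) M F)

Tails↔Fin : ∀ s M F → Tails s M F ↔ Fin (#tails s M F)
Tails↔Fin zero    zero    zero    = Irrelevant⇒↔Fin1 (λ { ([] , refl , refl) ([] , refl , refl) → refl }) ([] , refl , refl)
Tails↔Fin zero    zero    (suc F) = ¬⇒↔Fin0 (λ { ([] , _ , ()) })
Tails↔Fin zero    (suc M) F       = ¬⇒↔Fin0 (λ { ([] , () , _) })
Tails↔Fin (suc s) zero    F       = ↔-trans drop-empty (Tails↔Fin s zero F)
  where
  drop-empty : Tails (suc s) zero F ↔ Tails s zero F
  drop-empty = mk↔ₛ′ (λ { ([] ∷ τ , c , d) → τ , c , d ; ((_ ∷ _) ∷ τ , () , d) }) (λ (τ , c , d) → [] ∷ τ , c , d)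
                     (λ _ → refl) (λ { ([] ∷ τ , c , d) → refl ; ((_ ∷ _) ∷ τ , () , d) })
Tails↔Fin (suc s) (suc M) zero    =
  ↔-trans split-head (⊎-Fin↔Fin (Tails↔Fin s (suc M) zero) (Tails↔Fin (suc s) M zero))
  where
  split-head : Tails (suc s) (suc M) zero ↔ (Tails s (suc M) zero ⊎ Tails (suc s) M zero)
  split-head = mk↔ₛ′
    (λ { ([] ∷ τ , c , d) → inj₁ (τ , c , d) ; ((true ∷ l) ∷ τ , c , d) → inj₂ (l ∷ τ , suc-injective c , d)
       ; ((false ∷ l) ∷ τ , c , ()) })
    (λ { (inj₁ (τ , c , d)) → [] ∷ τ , c , d ; (inj₂ (l ∷ τ , c , d)) → (true ∷ l) ∷ τ , cong suc c , d })
    (λ { (inj₁ _) → refl ; (inj₂ (l ∷ τ , c , d)) → cong (λ cd → inj₂ (l ∷ τ , cd)) (×-irrelevant uip uip _ _) })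
    (λ { ([] ∷ τ , c , d) → refl ; ((true ∷ l) ∷ τ , c , d) → cong ((true ∷ l) ∷ τ ,_) (×-irrelevant uip uip _ _)
       ; ((false ∷ l) ∷ τ , c , ()) })
Tails↔Fin (suc s) (suc M) (suc F) = ↔-trans split-head
  (⊎-Fin↔Fin (Tails↔Fin s (suc M) (suc F)) (⊎-Fin↔Fin (Tails↔Fin (suc s) M (suc F)) (Tails↔Fin (suc s) M F)))
  where
  split-head : Tails (suc s) (suc M) (suc F) ↔ (Tails s (suc M) (suc F) ⊎ (Tails (suc s) M (suc F) ⊎ Tails (suc s) M F))
  split-head = mk↔ₛ′
    (λ { ([] ∷ τ , c , d) → inj₁ (τ , c , d)
       ; ((true ∷ l) ∷ τ , c , d) → inj₂ (inj₁ (l ∷ τ , suc-injective c , d))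
       ; ((false ∷ l) ∷ τ , c , d) → inj₂ (inj₂ (l ∷ τ , suc-injective c , suc-injective d)) })
    (λ { (inj₁ (τ , c , d)) → [] ∷ τ , c , d
       ; (inj₂ (inj₁ (l ∷ τ , c , d))) → (true ∷ l) ∷ τ , cong suc c , d
       ; (inj₂ (inj₂ (l ∷ τ , c , d))) → (false ∷ l) ∷ τ , cong suc c , cong suc d })
    (λ { (inj₁ _) → refl
       ; (inj₂ (inj₁ (l ∷ τ , c , d))) → cong (λ cd → inj₂ (inj₁ (l ∷ τ , cd))) (×-irrelevant uip uip _ _)
       ; (inj₂ (inj₂ (l ∷ τ , c , d))) → cong (λ cd → inj₂ (inj₂ (l ∷ τ , cd))) (×-irrelevant uip uip _ _) })
    (λ { ([] ∷ τ , c , d) → refl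
       ; ((true ∷ l) ∷ τ , c , d) → cong ((true ∷ l) ∷ τ ,_) (×-irrelevant uip uip _ _)
       ; ((false ∷ l) ∷ τ , c , d) → cong ((false ∷ l) ∷ τ ,_) (×-irrelevant uip uip _ _) })

#tailsFor : ℕ → ℕ → ℕ → ℕ → ℕ
#tailsFor n s j m with m + j ≤? n
... | yes _ = #tails s (n ∸ (m + j)) (s ∸ suc m)
... | no  _ = 0

TailsFor↔Fin : ∀ n s j m → m < s → TailsFor n s j m ↔ Fin (#tailsFor n s j m)
TailsFor↔Fin n s j m m<s with m + j ≤? n
... | yes m+j≤n = ↔-trans (Σ-↔-irrelevant ↔-refl (λ _ → ×-irrelevant uip uip) (λ _ → ×-irrelevant uip uip) to from)
                           (Tails↔Fin s (n ∸ (m + j)) (s ∸ suc m))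
  where
  shift : ∀ m t → m + t + 1 ≡ suc m + t
  shift = solve-∀
  to : ∀ τ → m + total #false (toList τ) + 1 ≡ s × m + j + total length (toList τ) ≡ n →
       total length (toList τ) ≡ n ∸ (m + j) × total #false (toList τ) ≡ s ∸ suc m
  to τ (tails , e) =
    sym (trans (cong (_∸ (m + j)) (sym e)) (m+n∸m≡n (m + j) _)) ,
    sym (trans (cong (_∸ suc m) (trans (sym tails) (shift m _))) (m+n∸m≡n (suc m) _))
  from : ∀ τ → total length (toList τ) ≡ n ∸ (m + j) × total #false (toList τ) ≡ s ∸ suc m →
         m + total #false (toList τ) + 1 ≡ s × m + j + total length (toList τ) ≡ n
  from τ (l , f) =
    trans (cong (λ k → m + k + 1) f) (trans (shift m (s ∸ suc m)) (m+[n∸m]≡n m<s)) ,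
    trans (cong (λ k → m + j + k) l) (m+[n∸m]≡n m+j≤n)
... | no m+j≰n = ¬⇒↔Fin0 (λ (τ , _ , e) → m+j≰n (subst (m + j ≤_) e (m≤m+n (m + j) _)))

#balanced : ℕ → ℕ → ℕ → ℕ
#balanced n s j = (j C s) * ∑ s (λ m → #compositions j m * #tailsFor n s j m)

BalancedWords↔Fin : ∀ n s j → BalancedWords (Stats n s) j ↔ Fin (#balanced n s j)
BalancedWords↔Fin n s j =
  ↔-trans (BalancedWords↔Parts n s j) (↔-trans (Parts↔Patterns×Compositions×Tails n s j)
    (×-Fin↔Fin (Patterns↔Fin j s)
      (Σ-Fin↔∑ s (λ m → Compositions j m × TailsFor n s j m) (λ m → #compositions j m * #tailsFor n s j m)
        (λ {m} m<s → ×-Fin↔Fin (Compositions↔Fin j m) (TailsFor↔Fin n s j m m<s)))))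

-- Counting trees

Stats-rotate : ∀ {n s} xs ys → Stats n s (xs ++ ys) → Stats n s (ys ++ xs)
Stats-rotate xs ys (e , u) = trans (total-rotate #children ys xs) e , trans (total-rotate #unprotected ys xs) u

ŁukWords-cancel : ∀ n s j →
  (ŁukWords (Stats n s) (suc j) ↔ Fin (#balanced n s (suc j) div suc j)) ×
  #balanced n s (suc j) div suc j * suc j ≡ #balanced n s (suc j)
ŁukWords-cancel n s j = ×-Fin-suc-cancel j _
  (↔-trans (cycle-lemma (Stats n s) Stats-rotate (λ _ → ×-irrelevant uip uip) j) (BalancedWords↔Fin n s (suc j)))

#ŁukWords : ℕ → ℕ → ℕ → ℕ
#ŁukWords n s zero    = 0
#ŁukWords n s (suc j) = #balanced n s (suc j) div suc j

ŁukWords↔Fin : ∀ n s j → ŁukWords (Stats n s) j ↔ Fin (#ŁukWords n s j)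
ŁukWords↔Fin n s zero    = ¬⇒↔Fin0 λ { ([] , (() , _) , _) ; (_ ∷ _ , (_ , ()) , _) }
ŁukWords↔Fin n s (suc j) = proj₁ (ŁukWords-cancel n s j)

#ŁukWords-cycle : ∀ n s j → #ŁukWords n s (suc j) * suc j ≡ #balanced n s (suc j)
#ŁukWords-cycle n s j = proj₂ (ŁukWords-cancel n s j)

length≤total-#children : ∀ (l : List Letter) → length l ≤ total #children l
length≤total-#children []      = z≤n
length≤total-#children (w ∷ l) = +-mono-≤ (s≤s z≤n) (length≤total-#children l)

ŁukCodes↔Σ-length : ∀ N s → ŁukCodes N s ↔ Σ (Fin (suc N)) (λ j → ŁukWords (Stats N s) (toℕ j))
ŁukCodes↔Σ-length N s = mk↔ₛ′ to from to∘from (λ _ → refl)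
  where
  |l|<N+1 : ∀ l → total #children l ≡ N → length l < suc N
  |l|<N+1 l e = s≤s (subst (length l ≤_) e (length≤total-#children l))
  to : ŁukCodes N s → Σ (Fin (suc N)) (λ j → ŁukWords (Stats N s) (toℕ j))
  to (l , p , st) = fromℕ< (|l|<N+1 l (proj₁ st)) , l , (p , sym (toℕ-fromℕ< _)) , st
  from : Σ (Fin (suc N)) (λ j → ŁukWords (Stats N s) (toℕ j)) → ŁukCodes N s
  from (_ , l , (p , _) , st) = l , p , st
  to∘from : ∀ x → to (from x) ≡ x
  to∘from (j , l , (p , |l|≡j) , st) = same-length (toℕ-injective (trans (toℕ-fromℕ< _) |l|≡j))
    where
    same-length : ∀ {j′} → j′ ≡ j → ∀ {|l|≡j′} →
                  _≡_ {A = Σ (Fin (suc N)) (λ j → ŁukWords (Stats N s) (toℕ j))}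
                      (j′ , l , (p , |l|≡j′) , st) (j , l , (p , |l|≡j) , st)
    same-length refl {|l|≡j′} rewrite uip |l|≡j′ |l|≡j = refl

#trees : ℕ → ℕ → ℕ
#trees n s = ∑ (suc n) (#ŁukWords n s)

Trees↔Fin : ∀ n s → 1 ≤ s → Trees n s ↔ Fin (#trees n s)
Trees↔Fin zero s 1≤s = ¬⇒↔Fin0 λ
  { (node [] , _ , u) → <-irrefl refl (subst (1 ≤_) (sym u) 1≤s)
  ; (node (_ ∷ _) , () , _) }
Trees↔Fin (suc n) s _ =
  ↔-trans (Trees↔ŁukCodes n s) (↔-trans (ŁukCodes↔Σ-length (suc n) s)
    (Σ-Fin↔∑ (suc (suc n)) (ŁukWords (Stats (suc n) s)) (#ŁukWords (suc n) s) (λ _ → ŁukWords↔Fin (suc n) s _)))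

-- Evaluating the formula

toℚ : ℕ → ℚ
toℚ a = + a / 1

toℚᵘ-toℚ : ∀ a → toℚᵘ (toℚ a) ℚᵘ.≃ mkℚᵘ (+ a) 0
toℚᵘ-toℚ a = toℚᵘ-fromℚᵘ (mkℚᵘ (+ a) 0)

toℚ-+ : ∀ a b → toℚ a ℚ.+ toℚ b ≡ toℚ (a + b)
toℚ-+ a b = toℚᵘ-injective (begin
  toℚᵘ (toℚ a ℚ.+ toℚ b)
    ≈⟨ toℚᵘ-homo-+ (toℚ a) (toℚ b) ⟩
  toℚᵘ (toℚ a) ℚᵘ.+ toℚᵘ (toℚ b)
    ≈⟨ ℚᵘ.+-cong (toℚᵘ-toℚ a) (toℚᵘ-toℚ b) ⟩
  mkℚᵘ (+ a) 0 ℚᵘ.+ mkℚᵘ (+ b) 0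
    ≈⟨ *≡* (cong (ℤ._* + 1) (cong₂ ℤ._+_ (ℤ.*-identityʳ (+ a)) (ℤ.*-identityʳ (+ b)))) ⟩
  mkℚᵘ (+ (a + b)) 0
    ≈⟨ toℚᵘ-toℚ (a + b) ⟨
  toℚᵘ (toℚ (a + b)) ∎)
  where open ℚᵘ.≃-Reasoning

toℚ-* : ∀ a b → toℚ a ℚ.* toℚ b ≡ toℚ (a * b)
toℚ-* a b = toℚᵘ-injective (begin
  toℚᵘ (toℚ a ℚ.* toℚ b)
    ≈⟨ toℚᵘ-homo-* (toℚ a) (toℚ b) ⟩
  toℚᵘ (toℚ a) ℚᵘ.* toℚᵘ (toℚ b)
    ≈⟨ ℚᵘ.*-cong (toℚᵘ-toℚ a) (toℚᵘ-toℚ b) ⟩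
  mkℚᵘ (+ a) 0 ℚᵘ.* mkℚᵘ (+ b) 0
    ≈⟨ *≡* (cong (ℤ._* + 1) (sym (ℤ.pos-* a b))) ⟩
  mkℚᵘ (+ (a * b)) 0
    ≈⟨ toℚᵘ-toℚ (a * b) ⟨
  toℚᵘ (toℚ (a * b)) ∎)
  where open ℚᵘ.≃-Reasoning

1/suc-*-toℚ : ∀ k V → (+ 1 / suc k) ℚ.* toℚ (V * suc k) ≡ toℚ V
1/suc-*-toℚ k V = toℚᵘ-injective (begin
  toℚᵘ ((+ 1 / suc k) ℚ.* toℚ (V * suc k))
    ≈⟨ toℚᵘ-homo-* (+ 1 / suc k) (toℚ (V * suc k)) ⟩
  toℚᵘ (+ 1 / suc k) ℚᵘ.* toℚᵘ (toℚ (V * suc k))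
    ≈⟨ ℚᵘ.*-cong (toℚᵘ-fromℚᵘ (mkℚᵘ (+ 1) k)) (toℚᵘ-toℚ (V * suc k)) ⟩
  mkℚᵘ (+ 1) k ℚᵘ.* mkℚᵘ (+ (V * suc k)) 0
    ≈⟨ *≡* cross ⟩
  mkℚᵘ (+ V) 0
    ≈⟨ toℚᵘ-toℚ V ⟨
  toℚᵘ (toℚ V) ∎)
  where
  open ℚᵘ.≃-Reasoning
  cross : + 1 ℤ.* + (V * suc k) ℤ.* + 1 ≡ + V ℤ.* + (suc k * 1)
  cross = trans (ℤ.*-identityʳ _) (trans (ℤ.*-identityˡ _)
            (trans (ℤ.pos-* V (suc k)) (cong (λ d → + V ℤ.* + d) (sym (*-identityʳ (suc k))))))

∑ℚ : ℕ → (ℕ → ℚ) → ℚ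
∑ℚ zero    f = 0ℚ
∑ℚ (suc n) f = f 0 ℚ.+ ∑ℚ n (λ k → f (suc k))

∑ℚ-cong : ∀ n {f g} → (∀ k → k < n → f k ≡ g k) → ∑ℚ n f ≡ ∑ℚ n g
∑ℚ-cong zero    f≡g = refl
∑ℚ-cong (suc n) f≡g = cong₂ ℚ._+_ (f≡g 0 (s≤s z≤n)) (∑ℚ-cong n (λ k k<n → f≡g (suc k) (s≤s k<n)))

toℚ-∑ : ∀ n f → toℚ (∑ n f) ≡ ∑ℚ n (λ k → toℚ (f k))
toℚ-∑ zero    f = refl
toℚ-∑ (suc n) f = trans (sym (toℚ-+ (f 0) _)) (cong (toℚ (f 0) ℚ.+_) (toℚ-∑ n (λ k → f (suc k))))

∑-drop-zeros : ∀ n s f → (∀ k → k < s → f k ≡ 0) → ∑ n f ≡ ∑ (n ∸ s) (λ k → f (s + k))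
∑-drop-zeros n       zero    f _      = refl
∑-drop-zeros zero    (suc s) f _      = refl
∑-drop-zeros (suc n) (suc s) f f<s≡0 =
  trans (cong (_+ ∑ n (λ k → f (suc k))) (f<s≡0 0 (s≤s z≤n)))
        (∑-drop-zeros n s (λ k → f (suc k)) (λ k k<s → f<s≡0 (suc k) (s≤s k<s)))

clamp-neg : ∀ x → clamp (ℤ.- (+ x)) ≡ 0
clamp-neg zero    = refl
clamp-neg (suc x) = refl

clamp-⊖ : ∀ m n → clamp (m ℤ.⊖ n) ≡ m ∸ n
clamp-⊖ m n with n ≤? m
... | yes n≤m = cong clamp (ℤ.⊖-≥ n≤m)
... | no  n≰m = trans (cong clamp (ℤ.⊖-< (≰⇒> n≰m)))
                     (trans (clamp-neg (n ∸ m)) (sym (m≤n⇒m∸n≡0 (<⇒≤ (≰⇒> n≰m)))))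

clamp-range : ∀ a b → clamp ((+ b ℤ.+ + 1) ℤ.- + a) ≡ suc b ∸ a
clamp-range a b = trans (cong clamp (ℤ.m-n≡m⊖n (b + 1) a)) (trans (clamp-⊖ (b + 1) a) (cong (_∸ a) (+-comm b 1)))

sumFromTo-empty : ∀ f a b → b < a → sumFromTo (+ a) (+ b) f ≡ 0ℚ
sumFromTo-empty f a b b<a = unfold (trans (clamp-range a b) (m≤n⇒m∸n≡0 b<a))
  where
  unfold : clamp ((+ b ℤ.+ + 1) ℤ.- + a) ≡ 0 → sumFromTo (+ a) (+ b) f ≡ 0ℚ
  unfold e rewrite e = refl

sumFromTo-step : ∀ f a b → a ≤ b → sumFromTo (+ a) (+ b) f ≡ f (+ a) ℚ.+ sumFromTo (+ suc a) (+ b) f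
sumFromTo-step f a b a≤b =
  trans (unfold (trans (clamp-range a b) (trans (+-∸-assoc 1 a≤b) (cong suc (sym range′)))))
        (cong (λ a′ → f (+ a) ℚ.+ sumFromTo (+ a′) (+ b) f) (+-comm a 1))
  where
  range′ : clamp ((+ b ℤ.+ + 1) ℤ.- + (a + 1)) ≡ b ∸ a
  range′ = trans (clamp-range (a + 1) b) (cong (suc b ∸_) (+-comm a 1))
  unfold : clamp ((+ b ℤ.+ + 1) ℤ.- + a) ≡ suc (clamp ((+ b ℤ.+ + 1) ℤ.- + (a + 1))) →
           sumFromTo (+ a) (+ b) f ≡ f (+ a) ℚ.+ sumFromTo (+ (a + 1)) (+ b) f
  unfold e rewrite e = refl

sumFromTo-∑ℚ : ∀ f a b → sumFromTo (+ a) (+ b) f ≡ ∑ℚ (suc b ∸ a) (λ k → f (+ (a + k)))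
sumFromTo-∑ℚ f a b = go (suc b ∸ a) a refl
  where
  go : ∀ c a → suc b ∸ a ≡ c → sumFromTo (+ a) (+ b) f ≡ ∑ℚ c (λ k → f (+ (a + k)))
  go zero    a e = sumFromTo-empty f a b (m∸n≡0⇒m≤n e)
  go (suc c) a e = begin
    sumFromTo (+ a) (+ b) f
      ≡⟨ sumFromTo-step f a b a≤b ⟩
    f (+ a) ℚ.+ sumFromTo (+ suc a) (+ b) f
      ≡⟨ cong₂ ℚ._+_ (cong (λ i → f (+ i)) (sym (+-identityʳ a))) (go c (suc a) |b∸a|≡c) ⟩
    f (+ (a + 0)) ℚ.+ ∑ℚ c (λ k → f (+ (suc a + k)))
      ≡⟨ cong (f (+ (a + 0)) ℚ.+_) (∑ℚ-cong c (λ k _ → cong (λ i → f (+ i)) (sym (+-suc a k)))) ⟩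
    f (+ (a + 0)) ℚ.+ ∑ℚ c (λ k → f (+ (a + suc k))) ∎
    where
    open ≡-Reasoning
    a≤b : a ≤ b
    a≤b = ≤-pred (m∸n≢0⇒n<m (λ e′ → 0≢1+n (trans (sym e′) e)))
    |b∸a|≡c : suc b ∸ suc a ≡ c
    |b∸a|≡c = suc-injective (trans (sym (+-∸-assoc 1 a≤b)) e)

#compositions-closed : ∀ j m → #compositions (suc j) m ≡ (j + m) C j
#compositions-closed j       zero    = trans (#compositions-zero j) (sym (trans (cong (_C j) (+-identityʳ j)) (nCn≡1 j)))
  where
  #compositions-zero : ∀ j → #compositions j zero ≡ 1
  #compositions-zero zero    = refl
  #compositions-zero (suc j) = #compositions-zero j
#compositions-closed zero    (suc m) = trans (#compositions-closed zero m) (trans (nC0≡1 m) (sym (nC0≡1 (suc m))))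
#compositions-closed (suc j) (suc m) = begin
  #compositions (suc j) (suc m) + #compositions (suc (suc j)) m
    ≡⟨ cong₂ _+_ (#compositions-closed j (suc m)) (#compositions-closed (suc j) m) ⟩
  (j + suc m) C j + suc (j + m) C suc j
    ≡⟨ cong (λ n → n C j + suc (j + m) C suc j) (+-suc j m) ⟩
  suc (j + m) C j + suc (j + m) C suc j
    ≡⟨ nCk+nC[k+1]≡[n+1]C[k+1] (suc (j + m)) j ⟩
  suc (suc (j + m)) C suc j
    ≡⟨ cong (λ n → suc n C suc j) (+-suc j m) ⟨
  suc (j + suc m) C suc j ∎
  where open ≡-Reasoning

#tails-closed : ∀ s M F → #tails s M F ≡ #compositions s M * (M C F)
#tails-closed zero    zero    zero    = refl
#tails-closed zero    zero    (suc F) = refl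
#tails-closed zero    (suc M) F       = refl
#tails-closed (suc s) zero    F       = #tails-closed s zero F
#tails-closed (suc s) (suc M) zero    = begin
  #tails s (suc M) zero + #tails (suc s) M zero
    ≡⟨ cong₂ _+_ (#tails-closed s (suc M) zero) (#tails-closed (suc s) M zero) ⟩
  a * (suc M C 0) + b * (M C 0)
    ≡⟨ cong₂ (λ x y → a * x + b * y) (nC0≡1 (suc M)) (nC0≡1 M) ⟩
  a * 1 + b * 1
    ≡⟨ *-distribʳ-+ 1 a b ⟨
  (a + b) * 1
    ≡⟨ cong ((a + b) *_) (nC0≡1 (suc M)) ⟨
  (a + b) * (suc M C 0) ∎
  where
  open ≡-Reasoning
  a b : ℕ
  a = #compositions s (suc M)
  b = #compositions (suc s) M
#tails-closed (suc s) (suc M) (suc F) = begin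
  #tails s (suc M) (suc F) + (#tails (suc s) M (suc F) + #tails (suc s) M F)
    ≡⟨ cong₂ _+_ (#tails-closed s (suc M) (suc F)) (cong₂ _+_ (#tails-closed (suc s) M (suc F)) (#tails-closed (suc s) M F)) ⟩
  a * (suc M C suc F) + (b * (M C suc F) + b * (M C F))
    ≡⟨ regroup a b (M C F) (M C suc F) ⟩
  a * (suc M C suc F) + b * (M C F + M C suc F)
    ≡⟨ cong (λ x → a * (suc M C suc F) + b * x) (nCk+nC[k+1]≡[n+1]C[k+1] M F) ⟩
  a * (suc M C suc F) + b * (suc M C suc F)
    ≡⟨ *-distribʳ-+ (suc M C suc F) a b ⟨
  (a + b) * (suc M C suc F) ∎
  where
  open ≡-Reasoning
  a b : ℕ
  a = #compositions s (suc M)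
  b = #compositions (suc s) M
  regroup : ∀ a b x y → a * (suc M C suc F) + (b * y + b * x) ≡ a * (suc M C suc F) + b * (x + y)
  regroup a b x y = cong (λ z → a * (suc M C suc F) + z) (trans (+-comm (b * y) (b * x)) (sym (*-distribˡ-+ b x y)))

-ℤ-≥ : ∀ {a b} → b ≤ a → + a ℤ.- + b ≡ + (a ∸ b)
-ℤ-≥ {a} {b} b≤a = trans (ℤ.m-n≡m⊖n a b) (ℤ.⊖-≥ b≤a)

-ℤ-< : ∀ {a b} → a < b → ∃ λ k → + a ℤ.- + b ≡ -[1+ k ]
-ℤ-< {a} {suc b} (s≤s a≤b) =
  b ∸ a , trans (ℤ.m-n≡m⊖n a (suc b)) (trans (ℤ.⊖-< (s≤s a≤b)) (cong (λ k → ℤ.- + k) (+-∸-assoc 1 a≤b)))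

summand : ℤ → ℤ → ℤ → ℤ → ℤ
summand n s j i = binom (i ℤ.- + 1) (j ℤ.- + 1)
          ℤ.* binom (n ℤ.+ s ℤ.- i ℤ.- + 1) (s ℤ.- + 1)
          ℤ.* binom (n ℤ.- i) (n ℤ.- s ℤ.- j ℤ.+ + 1)

-ℤ-+ : ∀ (x y z : ℤ) → x ℤ.- y ℤ.- z ≡ x ℤ.- (y ℤ.+ z)
-ℤ-+ = ℤ-Solver.solve-∀

lower-index : ∀ (n s j : ℤ) → n ℤ.- s ℤ.- j ℤ.+ + 1 ≡ (n ℤ.+ + 1) ℤ.- (s ℤ.+ j)
lower-index = ℤ-Solver.solve-∀

module Summand (j′ m M F : ℕ) where
  j i n s : ℕ
  j = suc j′
  i = j + m
  n = m + j + M
  s = suc (m + F)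

  factor₁ : binom (+ i ℤ.- + 1) (+ j ℤ.- + 1) ≡ + #compositions j m
  factor₁ = cong +_ (sym (#compositions-closed j′ m))

  factor₂ : binom (+ n ℤ.+ + s ℤ.- + i ℤ.- + 1) (+ s ℤ.- + 1) ≡ + #compositions s M
  factor₂ = begin
    binom (+ (n + s) ℤ.- + i ℤ.- + 1) (+ (m + F))
      ≡⟨ cong (λ x → binom x (+ (m + F))) (trans (-ℤ-+ (+ (n + s)) (+ i) (+ 1)) (-ℤ-≥ i+1≤n+s)) ⟩
    + ((n + s ∸ (i + 1)) C (m + F))
      ≡⟨ cong (λ x → + (x C (m + F))) n+s∸[i+1]≡ ⟩
    + ((m + F + M) C (m + F))
      ≡⟨ cong +_ (#compositions-closed (m + F) M) ⟨
    + #compositions s M ∎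
    where
    open ≡-Reasoning
    regroup : ∀ m j M F → m + j + M + suc (m + F) ≡ j + m + 1 + (m + F + M)
    regroup = solve-∀
    i+1≤n+s : i + 1 ≤ n + s
    i+1≤n+s = subst (i + 1 ≤_) (sym (regroup m j M F)) (m≤m+n (i + 1) _)
    n+s∸[i+1]≡ : n + s ∸ (i + 1) ≡ m + F + M
    n+s∸[i+1]≡ = trans (cong (_∸ (i + 1)) (regroup m j M F)) (m+n∸m≡n (i + 1) _)

  -- For F > M the lower index n − s − j + 1 is negative, where binom vanishes like M C F.
  factor₃ : binom (+ n ℤ.- + i) (+ n ℤ.- + s ℤ.- + j ℤ.+ + 1) ≡ + (M C F)
  factor₃ = trans (cong₂ binom upper (lower-index (+ n) (+ s) (+ j))) (lemma (F ≤? M))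
    where
    open ≡-Reasoning
    n∸i≡M : n ∸ i ≡ M
    n∸i≡M = trans (cong (_∸ i) (cong (_+ M) (+-comm m j))) (m+n∸m≡n i M)
    upper : + n ℤ.- + i ≡ + M
    upper = trans (-ℤ-≥ (subst (_≤ n) (+-comm m j) (m≤m+n (m + j) M))) (cong +_ n∸i≡M)
    c : ℕ
    c = m + j + 1
    n+1≡c+M : n + 1 ≡ c + M
    n+1≡c+M = regroup (m + j) M
      where
      regroup : ∀ a b → a + b + 1 ≡ a + 1 + b
      regroup = solve-∀
    s+j≡c+F : s + j ≡ c + F
    s+j≡c+F = regroup m j F
      where
      regroup : ∀ m j F → suc (m + F) + j ≡ m + j + 1 + F
      regroup = solve-∀
    lemma : Dec (F ≤ M) → binom (+ M) (+ (n + 1) ℤ.- + (s + j)) ≡ + (M C F)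
    lemma (yes F≤M) = begin
      binom (+ M) (+ (n + 1) ℤ.- + (s + j))
        ≡⟨ cong (binom (+ M)) (-ℤ-≥ (subst₂ _≤_ (sym s+j≡c+F) (sym n+1≡c+M) (+-monoʳ-≤ c F≤M))) ⟩
      + (M C (n + 1 ∸ (s + j)))
        ≡⟨ cong (λ k → + (M C k)) (trans (cong₂ _∸_ n+1≡c+M s+j≡c+F) ([m+n]∸[m+o]≡n∸o c M F)) ⟩
      + (M C (M ∸ F))
        ≡⟨ cong +_ (nCk≡nC[n∸k] F≤M) ⟨
      + (M C F) ∎
    lemma (no F≰M) with -ℤ-< (subst₂ _<_ (sym n+1≡c+M) (sym s+j≡c+F) (+-monoʳ-< c (≰⇒> F≰M)))
    ... | k , e = trans (cong (binom (+ M)) e) (cong +_ (sym (k>n⇒nCk≡0 (≰⇒> F≰M))))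

  summand≡ : summand (+ n) (+ s) (+ j) (+ i) ≡ + (#compositions j m * #tails s M F)
  summand≡ = begin
    summand (+ n) (+ s) (+ j) (+ i)
      ≡⟨ cong₂ ℤ._*_ (cong₂ ℤ._*_ factor₁ factor₂) factor₃ ⟩
    + #compositions j m ℤ.* + #compositions s M ℤ.* + (M C F)
      ≡⟨ cong (ℤ._* + (M C F)) (ℤ.pos-* (#compositions j m) _) ⟨
    + (#compositions j m * #compositions s M) ℤ.* + (M C F)
      ≡⟨ ℤ.pos-* (#compositions j m * #compositions s M) (M C F) ⟨
    + (#compositions j m * #compositions s M * (M C F))
      ≡⟨ cong +_ (*-assoc (#compositions j m) _ _) ⟩
    + (#compositions j m * (#compositions s M * (M C F)))
      ≡⟨ cong (λ t → + (#compositions j m * t)) (#tails-closed s M F) ⟨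
    + (#compositions j m * #tails s M F) ∎
    where open ≡-Reasoning

-- Splitting on m + j ≤? n also unfolds #tailsFor in the goal.
summand-value : ∀ n s′ j′ m → m ≤ s′ →
  summand (+ n) (+ suc s′) (+ suc j′) (+ (suc j′ + m)) ≡ + (#compositions (suc j′) m * #tailsFor n (suc s′) (suc j′) m)
summand-value n s′ j′ m m≤s′ with m + suc j′ ≤? n
... | yes m+j≤n = via (n ∸ (m + suc j′)) (s′ ∸ m) (sym (m+[n∸m]≡n m+j≤n)) (sym (m+[n∸m]≡n m≤s′))
  where
  via : ∀ {n s′} M F → n ≡ m + suc j′ + M → s′ ≡ m + F →
        summand (+ n) (+ suc s′) (+ suc j′) (+ (suc j′ + m)) ≡ + (#compositions (suc j′) m * #tails (suc s′) M F)
  via M F refl refl = Summand.summand≡ j′ m M F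
... | no m+j≰n with -ℤ-< n+1<s+j
  where
  n+1<s+j : n + 1 < suc s′ + suc j′
  n+1<s+j = subst (_< suc s′ + suc j′) (+-comm 1 n) (s≤s (≤-trans (≰⇒> m+j≰n) (+-monoˡ-≤ (suc j′) m≤s′)))
...   | k , e = begin
  summand (+ n) (+ suc s′) (+ suc j′) (+ (suc j′ + m))
    ≡⟨ cong (λ x → first-two ℤ.* binom (+ n ℤ.- + (suc j′ + m)) x) (trans (lower-index (+ n) (+ suc s′) (+ suc j′)) e) ⟩
  first-two ℤ.* + 0
    ≡⟨ ℤ.*-zeroʳ first-two ⟩
  + 0
    ≡⟨ cong +_ (*-zeroʳ (#compositions (suc j′) m)) ⟨
  + (#compositions (suc j′) m * 0) ∎
  where
  open ≡-Reasoning
  first-two : ℤ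
  first-two = binom (+ (suc j′ + m) ℤ.- + 1) (+ suc j′ ℤ.- + 1)
              ℤ.* binom (+ n ℤ.+ + suc s′ ℤ.- + (suc j′ + m) ℤ.- + 1) (+ suc s′ ℤ.- + 1)

term : ℤ → ℤ → ℤ → ℚ
term n s j = recip j ℚ.* (binom j s / 1) ℚ.* sumFromTo j (s ℤ.+ j ℤ.- + 1) (λ i → summand n s j i / 1)

inner-sum : ∀ n s′ j′ →
  sumFromTo (+ suc j′) (+ suc s′ ℤ.+ + suc j′ ℤ.- + 1) (λ i → summand (+ n) (+ suc s′) (+ suc j′) i / 1)
    ≡ toℚ (∑ (suc s′) (λ m → #compositions (suc j′) m * #tailsFor n (suc s′) (suc j′) m))
inner-sum n s′ j′ = begin
  sumFromTo (+ j) (+ (s′ + j)) g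
    ≡⟨ sumFromTo-∑ℚ g j (s′ + j) ⟩
  ∑ℚ (suc (s′ + j) ∸ j) (λ k → g (+ (j + k)))
    ≡⟨ cong (λ c → ∑ℚ c (λ k → g (+ (j + k)))) (m+n∸n≡m (suc s′) j) ⟩
  ∑ℚ (suc s′) (λ k → g (+ (j + k)))
    ≡⟨ ∑ℚ-cong (suc s′) (λ k k<s → cong (_/ 1) (summand-value n s′ j′ k (≤-pred k<s))) ⟩
  ∑ℚ (suc s′) (λ k → toℚ (#compositions j k * #tailsFor n s j k))
    ≡⟨ toℚ-∑ (suc s′) (λ k → #compositions j k * #tailsFor n s j k) ⟨
  toℚ (∑ (suc s′) (λ k → #compositions j k * #tailsFor n s j k)) ∎
  where
  open ≡-Reasoning
  j s : ℕ
  j = suc j′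
  s = suc s′
  g : ℤ → ℚ
  g i = summand (+ n) (+ s) (+ j) i / 1

term-value : ∀ n s′ j′ → term (+ n) (+ suc s′) (+ suc j′) ≡ toℚ (#ŁukWords n (suc s′) (suc j′))
term-value n s′ j′ = begin
  (+ 1 / suc j′) ℚ.* toℚ (j C s) ℚ.* sumFromTo (+ j) (+ s ℤ.+ + j ℤ.- + 1) g
    ≡⟨ cong (((+ 1 / suc j′) ℚ.* toℚ (j C s)) ℚ.*_) (inner-sum n s′ j′) ⟩
  (+ 1 / suc j′) ℚ.* toℚ (j C s) ℚ.* toℚ X
    ≡⟨ ℚ.*-assoc (+ 1 / suc j′) (toℚ (j C s)) (toℚ X) ⟩
  (+ 1 / suc j′) ℚ.* (toℚ (j C s) ℚ.* toℚ X)
    ≡⟨ cong ((+ 1 / suc j′) ℚ.*_) (toℚ-* (j C s) X) ⟩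
  (+ 1 / suc j′) ℚ.* toℚ (#balanced n s j)
    ≡⟨ cong (λ b → (+ 1 / suc j′) ℚ.* toℚ b) (#ŁukWords-cycle n s j′) ⟨
  (+ 1 / suc j′) ℚ.* toℚ (#ŁukWords n s j * j)
    ≡⟨ 1/suc-*-toℚ j′ (#ŁukWords n s j) ⟩
  toℚ (#ŁukWords n s j) ∎
  where
  open ≡-Reasoning
  j s X : ℕ
  j = suc j′
  s = suc s′
  X = ∑ s (λ m → #compositions j m * #tailsFor n s j m)
  g : ℤ → ℚ
  g i = summand (+ n) (+ s) (+ j) i / 1

#ŁukWords-below : ∀ n s j → j < s → #ŁukWords n s j ≡ 0
#ŁukWords-below n s zero    _   = refl
#ŁukWords-below n s (suc j) j<s =
  trans (cong (λ c → c * ∑ s (λ m → #compositions (suc j) m * #tailsFor n s (suc j) m) div suc j) (k>n⇒nCk≡0 j<s))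
        (0/n≡0 (suc j))

toℚ-#trees : ∀ n s → 1 ≤ s → toℚ (#trees n s) ≡ formula (+ n) (+ s)
toℚ-#trees n s@(suc s′) _ = begin
  toℚ (∑ (suc n) (#ŁukWords n s))
    ≡⟨ cong toℚ (∑-drop-zeros (suc n) s (#ŁukWords n s) (#ŁukWords-below n s)) ⟩
  toℚ (∑ (suc n ∸ s) (λ k → #ŁukWords n s (s + k)))
    ≡⟨ toℚ-∑ (suc n ∸ s) (λ k → #ŁukWords n s (s + k)) ⟩
  ∑ℚ (suc n ∸ s) (λ k → toℚ (#ŁukWords n s (s + k)))
    ≡⟨ ∑ℚ-cong (suc n ∸ s) (λ k _ → term-value n s′ (s′ + k)) ⟨
  ∑ℚ (suc n ∸ s) (λ k → term (+ n) (+ s) (+ (s + k)))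
    ≡⟨ sumFromTo-∑ℚ (term (+ n) (+ s)) s n ⟨
  formula (+ n) (+ s) ∎
  where open ≡-Reasoning

proposition5 : (n s : ℕ) → 1 ≤ s →
    ∃ λ (N : ℕ) →
      (Σ Tree (λ t → edges t ≡ n × unprotected t ≡ s) ↔ Fin N)
      × (+ N / 1 ≡ formula (+ n) (+ s))
proposition5 n s 1≤s = #trees n s , Trees↔Fin n s 1≤s , toℚ-#trees n s 1≤s
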